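{- Let $m,n,k$ be integers with $n,m\geq k\geq 0$. There is a bijection between $\mathrm{PF}^2(m,n)^{\ast k}$ and the set of $(k,n,m)$-shuffle paths which preserves both statistics $\mathrm{dinv}$ and $\mathrm{area}$.
   Context: A Dyck path of size $N$ is a lattice path from $(0,0)$ to $(N,N)$ with unit North and East steps staying weakly above the line $y=x$. A labelled Dyck path is a Dyck path whose vertical steps carry positive integer labels, strictly increasing from bottom to top within each column; $l_i(D)$ is the label of the $i$-th vertical step (from the bottom). The area word is $a_1(D)\cdots a_N(D)$, where $a_i(D)$ is the number of whole squares in the $i$-th row between the path and the diagonal. The rises are the indices $2\le i\le N$ with $a_i(D)>a_{i-1}(D)$. A decorated Dyck path is one in which some rises are marked with $\ast$; let $\mathrm{DRise}(D)$ be the set of decorated rises. Then $\mathrm{area}(D)=\sum_{i\notin \mathrm{DRise}(D)}a_i(D)$. For $1\le i<j\le N$, $(i,j)$ is a diagonal inversion if either $a_i(D)=a_j(D)$ and $l_i(D)<l_j(D)$, or $a_i(D)=a_j(D)+1$ and $l_i(D)>l_j(D)$; $\mathrm{dinv}(D)$ is the number of diagonal inversions (decorations are ignored). The dinv reading word of $D$ lists the labels by reading the cells on the diagonal $y=x$ bottom to top, then those on $y=x+1$ bottom to top, then $y=x+2$, etc. $\mathrm{PF}^2(m,n)^{\ast k}$ is the set of decorated labelled Dyck paths of size $m+n$ with exactly $k$ decorated rises, whose labels are all in $\{1,2\}$, with exactly $n$ labels equal to $1$ and $m$ labels equal to $2$. A $(k,n,m)$-shuffle path is an undecorated labelled Dyck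 path of size $m+n-k$ whose labels are exactly $1,2,\dots,m+n-k$ (each once) and whose dinv reading word is a shuffle of the three sequences $(1,2,\dots,k)$, $(n,n-1,\dots,k+1)$ and $(m+n-k,\dots,n+1)$ (i.e. each of these appears as a subsequence in the given order). -}

module Defs where

open import Data.Bool using (Bool; true; false; _∧_; _∨_; not; T)
open import Data.Nat using (ℕ; zero; suc; _+_; _∸_; _≤_; _<_; _≡ᵇ_; _<ᵇ_)
open import Data.List using (List; []; _∷_; length; map; zip; upTo; take; filterᵇ; concatMap)
open import Data.Nat.ListAction using (sum)
open import Data.List.Relation.Unary.All using (All)
open import Data.List.Relation.Unary.AllPairs using (AllPairs)
open import Data.List.Relation.Binary.Permutation.Propositional using (_↭_)
open import Data.List.Relation.Binary.Sublist.Propositional using (_⊆_)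
open import Data.Product using (_×_; _,_; proj₁; proj₂)
open import Data.Sum using (_⊎_)
open import Relation.Binary.PropositionalEquality using (_≡_)

data Step : Set where
  N E : Step

numN : List Step → ℕ
numN []      = 0
numN (N ∷ p) = suc (numN p)
numN (E ∷ p) = numN p

numE : List Step → ℕ
numE []      = 0
numE (N ∷ p) = numE p
numE (E ∷ p) = suc (numE p)

-- Dyck path of size s: from (0,0) to (s,s), weakly above y = x
-- (every prefix has at least as many N as E steps).
IsDyck : ℕ → List Step → Set
IsDyck s p = numN p ≡ s × numE p ≡ s × (∀ i → numE (take i p) ≤ numN (take i p))

-- For each vertical step (bottom to top): its x-coordinate
-- (= number of E steps before it) and its row index minus one (= N steps before it).
vertAux : ℕ → ℕ → List Step → List (ℕ × ℕ)
vertAux ns es []      = []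
vertAux ns es (N ∷ p) = (es , ns) ∷ vertAux (suc ns) es p
vertAux ns es (E ∷ p) = vertAux ns (suc es) p

columns : List Step → List ℕ
columns p = map proj₁ (vertAux 0 0 p)

-- area word a_1 ... a_N : number of whole squares in row i between path and diagonal,
-- namely (i-1) - x_i
areaWord : List Step → List ℕ
areaWord p = map (λ q → proj₂ q ∸ proj₁ q) (vertAux 0 0 p)

-- rise flags: position i (1-based) is a rise iff 2 ≤ i and a_i > a_{i-1}
riseAux : ℕ → List ℕ → List Bool
riseAux prev []       = []
riseAux prev (b ∷ bs) = (prev <ᵇ b) ∷ riseAux b bs

riseFlags : List ℕ → List Bool
riseFlags []       = []
riseFlags (a ∷ as) = false ∷ riseAux a as

ColumnIncreasing : List Step → List ℕ → Set
ColumnIncreasing p ls =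
  AllPairs (λ u v → proj₁ u ≡ proj₁ v → proj₂ u < proj₂ v) (zip (columns p) ls)

countPairs : {A : Set} → (A → A → Bool) → List A → ℕ
countPairs r []       = 0
countPairs r (x ∷ xs) = length (filterᵇ (r x) xs) + countPairs r xs

countTrue : List Bool → ℕ
countTrue bs = length (filterᵇ (λ b → b) bs)

countEq : ℕ → List ℕ → ℕ
countEq v ls = length (filterᵇ (λ l → l ≡ᵇ v) ls)

dinvRel : ℕ × ℕ → ℕ × ℕ → Bool
dinvRel (ai , li) (aj , lj) = ((ai ≡ᵇ aj) ∧ (li <ᵇ lj)) ∨ ((ai ≡ᵇ suc aj) ∧ (lj <ᵇ li))

dinvOf : List Step → List ℕ → ℕ
dinvOf p ls = countPairs dinvRel (zip (areaWord p) ls)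

areaOf : List Step → List Bool → ℕ
areaOf p ds = sum (map (λ q → if-not (proj₁ q) (proj₂ q)) (zip ds (areaWord p)))
  where
  if-not : Bool → ℕ → ℕ
  if-not true  _ = 0
  if-not false a = a

-- dinv reading word: labels on diagonal a = 0 bottom to top, then a = 1, etc.
-- (a_i < s for a Dyck path of size s, so diagonals 0 .. s-1 suffice)
labelsOnDiag : ℕ → List (ℕ × ℕ) → List ℕ
labelsOnDiag d []             = []
labelsOnDiag d ((a , l) ∷ xs) with a ≡ᵇ d
... | true  = l ∷ labelsOnDiag d xs
... | false = labelsOnDiag d xs

readingWord : List Step → List ℕ → List ℕ
readingWord p ls = concatMap (λ d → labelsOnDiag d (zip (areaWord p) ls)) (upTo (length ls))

-- Elements of PF²(m,n)^{*k}: decorated labelled Dyck paths of size m+n,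
-- labels in {1,2}, n labels equal to 1, m equal to 2, exactly k decorated rises.
record PF2 (m n k : ℕ) : Set where
  field
    path      : List Step
    labels    : List ℕ
    decor     : List Bool
    dyck      : IsDyck (m + n) path
    labLen    : length labels ≡ m + n
    decLen    : length decor ≡ m + n
    labPos    : All (λ l → 1 ≤ l) labels
    colInc    : ColumnIncreasing path labels
    decRise   : All (λ q → proj₁ q ≡ true → proj₂ q ≡ true) (zip decor (riseFlags (areaWord path)))
    labIn12   : All (λ l → l ≡ 1 ⊎ l ≡ 2) labels
    numOnes   : countEq 1 labels ≡ n
    numTwos   : countEq 2 labels ≡ m
    numDec    : countTrue decor ≡ k

range : ℕ → ℕ → List ℕ
range a zero    = []
range a (suc b) = a ∷ range (suc a) b

revRange : ℕ → ℕ → List ℕ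
revRange a zero    = []
revRange a (suc b) = (a + b) ∷ revRange a b

-- (k,n,m)-shuffle paths: undecorated labelled Dyck paths of size m+n-k with labels
-- exactly 1..m+n-k (each once) whose dinv reading word contains
-- (1,...,k), (n,...,k+1), (m+n-k,...,n+1) as subsequences.
record Shuffle (k n m : ℕ) : Set where
  field
    path      : List Step
    labels    : List ℕ
    dyck      : IsDyck (m + n ∸ k) path
    labLen    : length labels ≡ m + n ∸ k
    labPos    : All (λ l → 1 ≤ l) labels
    colInc    : ColumnIncreasing path labels
    labPerm   : labels ↭ range 1 (m + n ∸ k)
    sub1      : range 1 k ⊆ readingWord path labels
    sub2      : revRange (suc k) (n ∸ k) ⊆ readingWord path labels
    sub3      : revRange (suc n) (m ∸ k) ⊆ readingWord path labels

pfData : ∀ {m n k} → PF2 m n k → List Step × List ℕ × List Bool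
pfData x = PF2.path x , PF2.labels x , PF2.decor x

shData : ∀ {k n m} → Shuffle k n m → List Step × List ℕ
shData y = Shuffle.path y , Shuffle.labels y

pfDinv : ∀ {m n k} → PF2 m n k → ℕ
pfDinv x = dinvOf (PF2.path x) (PF2.labels x)

pfArea : ∀ {m n k} → PF2 m n k → ℕ
pfArea x = areaOf (PF2.path x) (PF2.decor x)

shDinv : ∀ {k n m} → Shuffle k n m → ℕ
shDinv y = dinvOf (Shuffle.path y) (Shuffle.labels y)

shArea : ∀ {k n m} → Shuffle k n m → ℕ
shArea y = sum (areaWord (Shuffle.path y))

-- In an element of PF²(m,n)^{*k} a column holds at most the labels 1 < 2, so a
-- decorated rise is always a column "1 below 2" immediately closed by an east step.
-- Hence such a path is a word of *tokens*: east steps, and north steps of three kinds: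
-- `pair` (the decorated domino N N E labelled 1,2), `one` (a row labelled 1) and `two`
-- (a row labelled 2).  Collapsing every pair to a single north step gives a Dyck path of
-- size m+n-k with the same area, since the decorated row does not count.  The collapsed
-- path is labelled by *standardisation*: in dinv reading order the pair rows receive
-- 1,…,k increasingly, the one rows n,…,k+1 and the two rows m+n-k,…,n+1 decreasingly,
-- so the reading word is a shuffle of the three prescribed sequences.  Conversely the
-- shuffle condition forces the labels of a shuffle path to be its standardisation,
-- which yields the inverse map.  Finally dinv is compared row against row: for any two
-- token rows, the diagonal inversions between their cells are the same before and after
-- collapsing.
module Submission where

open import Defs
open import Function using (_∘_; id; Equivalence)
open import Data.Bool using (Bool; true; false; _∧_; _∨_; T; if_then_else_)
open import Data.Bool.Properties using (T-∧; T-≡; ∧-zeroʳ; ∧-identityʳ; ∨-identityʳ)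
open import Data.Nat using (ℕ; zero; suc; _+_; _∸_; _≤_; _<_; _≡ᵇ_; _<ᵇ_; z≤n; s≤s; _≤ᵇ_; pred)
open import Data.Nat.Properties
open import Data.Nat.ListAction using (sum)
open import Data.Nat.ListAction.Properties using (sum-++)
open import Data.List using (List; []; _∷_; length; map; zip; upTo; take; filterᵇ; concatMap; _++_)
open import Data.List.Properties
  using (++-assoc; ++-identityʳ; length-++; applyUpTo-∷ʳ; map-++; length-map; map-∘; map-cong-local;
         ∷-injective; ∷-injectiveˡ; ∷-injectiveʳ;
         concatMap-++; concatMap-cong; map-concatMap; filter-++; filter-accept; filter-reject; filter-all; filter-none)
open import Data.List.Relation.Unary.All using (All; []; _∷_)
import Data.List.Relation.Unary.All as All
import Data.List.Relation.Unary.All.Properties as Allₚ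
open import Data.List.Relation.Unary.AllPairs using (AllPairs; []; _∷_)
import Data.List.Relation.Unary.AllPairs.Properties as AllPairsₚ
open import Data.List.Relation.Binary.Permutation.Propositional
  using (_↭_; ↭-refl; ↭-prep; ↭-sym; ↭-trans; module PermutationReasoning)
open import Data.List.Relation.Binary.Permutation.Propositional.Properties
  using (↭-length; filter-↭; shift; ++⁺; ++⁺ˡ; ++⁺ʳ; ∷↭∷ʳ; All-resp-↭)
import Data.List.Relation.Binary.Permutation.Propositional.Properties as ↭ₚ
open import Data.List.Relation.Binary.Sublist.Propositional using (_⊆_)
import Data.List.Relation.Binary.Sublist.Propositional.Properties as Sublistₚ
open import Data.List.Relation.Binary.Equality.Propositional using (≋⇒≡)
open import Data.Product using (Σ; _×_; _,_; proj₁; proj₂)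
open import Data.Sum using (_⊎_; inj₁; inj₂)
open import Data.Empty using (⊥; ⊥-elim)
open import Data.Unit using (⊤; tt)
open import Relation.Binary.PropositionalEquality
open import Relation.Nullary using (¬_)
open import Relation.Nullary.Decidable using (T?)

-- Walk h p : starting at height h above the diagonal, the path p never goes below it
-- and ends on it.  For h = 0 this is exactly the Dyck condition, in a form that
-- unfolds one step at a time.
Walk : ℕ → List Step → Set
Walk h       []      = h ≡ 0
Walk h       (N ∷ p) = Walk (suc h) p
Walk zero    (E ∷ p) = ⊥
Walk (suc h) (E ∷ p) = Walk h p

walk⇒prefixes : ∀ h p → Walk h p → ∀ i → numE (take i p) ≤ h + numN (take i p)
walk⇒prefixes h p w zero = z≤n
walk⇒prefixes h [] w (suc i) = z≤n
walk⇒prefixes h (N ∷ p) w (suc i) =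
  subst (numE (take i p) ≤_) (sym (+-suc h _)) (walk⇒prefixes (suc h) p w i)
walk⇒prefixes (suc h) (E ∷ p) w (suc i) = s≤s (walk⇒prefixes h p w i)

walk⇒balanced : ∀ h p → Walk h p → numE p ≡ h + numN p
walk⇒balanced h [] w = sym (trans (+-identityʳ h) w)
walk⇒balanced h (N ∷ p) w = trans (walk⇒balanced (suc h) p w) (sym (+-suc h _))
walk⇒balanced (suc h) (E ∷ p) w = cong suc (walk⇒balanced h p w)

prefixes⇒walk : ∀ h p → (∀ i → numE (take i p) ≤ h + numN (take i p)) →
                numE p ≡ h + numN p → Walk h p
prefixes⇒walk h [] pr eq = sym (trans eq (+-identityʳ h))
prefixes⇒walk h (N ∷ p) pr eq =
  prefixes⇒walk (suc h) p (λ i → subst (numE (take i p) ≤_) (+-suc h _) (pr (suc i)))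
                (trans eq (+-suc h _))
prefixes⇒walk zero (E ∷ p) pr eq with pr 1
... | ()
prefixes⇒walk (suc h) (E ∷ p) pr eq = prefixes⇒walk h p (λ i → ≤-pred (pr (suc i))) (suc-injective eq)

dyck⇒walk : ∀ {s} p → IsDyck s p → Walk 0 p
dyck⇒walk p (#N , #E , above) = prefixes⇒walk 0 p above (trans #E (sym #N))

walk⇒dyck : ∀ {s} p → Walk 0 p → numN p ≡ s → IsDyck s p
walk⇒dyck p w #N = #N , trans (walk⇒balanced 0 p w) #N , walk⇒prefixes 0 p w

heights : ℕ → List Step → List ℕ
heights h [] = []
heights h (N ∷ p) = h ∷ heights (suc h) p
heights h (E ∷ p) = heights (pred h) p

areaWordFrom≡heights : ∀ h ns es p → Walk h p → es + h ≡ ns →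
                       map (λ q → proj₂ q ∸ proj₁ q) (vertAux ns es p) ≡ heights h p
areaWordFrom≡heights h ns es [] w e = refl
areaWordFrom≡heights h ns es (N ∷ p) w e =
  cong₂ _∷_ (trans (cong (_∸ es) (sym e)) (m+n∸m≡n es h))
            (areaWordFrom≡heights (suc h) (suc ns) es p w (trans (+-suc es h) (cong suc e)))
areaWordFrom≡heights (suc h) ns es (E ∷ p) w e =
  areaWordFrom≡heights h ns (suc es) p w (trans (sym (+-suc es h)) e)

areaWord≡heights : ∀ p → Walk 0 p → areaWord p ≡ heights 0 p
areaWord≡heights p w = areaWordFrom≡heights 0 0 0 p w refl

-- Every height of a walk of size s is below s, so the reading word (which scans the
-- diagonals 0,…,s-1) sees every row.
heights-bound : ∀ h ns p → Walk h p → h ≤ ns → All (_< ns + numN p) (heights h p)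
heights-bound h ns [] w le = []
heights-bound h ns (N ∷ p) w le =
  ≤-trans (s≤s le) (subst (suc ns ≤_) (sym (+-suc ns (numN p))) (s≤s (m≤m+n ns (numN p))))
  ∷ subst (λ u → All (_< u) (heights (suc h) p)) (sym (+-suc ns (numN p)))
          (heights-bound (suc h) (suc ns) p w (s≤s le))
heights-bound (suc h) ns (E ∷ p) w le = heights-bound h ns p w (≤-trans (n≤1+n h) le)

-- The three kinds of rows of a PF² path: a decorated domino carrying the labels 1 and 2,
-- a single row labelled 1, and a single row labelled 2.
data Kind : Set where
  pair one two : Kind

data Token : Set where
  east  : Token
  north : Kind → Token

pfPath : List Token → List Step
pfPath [] = []
pfPath (east ∷ bs) = E ∷ pfPath bs
pfPath (north pair ∷ bs) = N ∷ N ∷ E ∷ pfPath bs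
pfPath (north one ∷ bs) = N ∷ pfPath bs
pfPath (north two ∷ bs) = N ∷ pfPath bs

pfLabels : List Token → List ℕ
pfLabels [] = []
pfLabels (east ∷ bs) = pfLabels bs
pfLabels (north pair ∷ bs) = 1 ∷ 2 ∷ pfLabels bs
pfLabels (north one ∷ bs) = 1 ∷ pfLabels bs
pfLabels (north two ∷ bs) = 2 ∷ pfLabels bs

pfDecor : List Token → List Bool
pfDecor [] = []
pfDecor (east ∷ bs) = pfDecor bs
pfDecor (north pair ∷ bs) = false ∷ true ∷ pfDecor bs
pfDecor (north one ∷ bs) = false ∷ pfDecor bs
pfDecor (north two ∷ bs) = false ∷ pfDecor bs

shPath : List Token → List Step
shPath [] = []
shPath (east ∷ bs) = E ∷ shPath bs
shPath (north κ ∷ bs) = N ∷ shPath bs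

kinds : List Token → List Kind
kinds [] = []
kinds (east ∷ bs) = kinds bs
kinds (north κ ∷ bs) = κ ∷ kinds bs

tokenize : List Step → List Kind → List Token
tokenize [] κs = []
tokenize (E ∷ q) κs = east ∷ tokenize q κs
tokenize (N ∷ q) [] = []
tokenize (N ∷ q) (κ ∷ κs) = north κ ∷ tokenize q κs

tokenize-shPath : ∀ bs → tokenize (shPath bs) (kinds bs) ≡ bs
tokenize-shPath [] = refl
tokenize-shPath (east ∷ bs) = cong (east ∷_) (tokenize-shPath bs)
tokenize-shPath (north κ ∷ bs) = cong (north κ ∷_) (tokenize-shPath bs)

shPath-tokenize : ∀ q κs → length κs ≡ numN q →
                  shPath (tokenize q κs) ≡ q × kinds (tokenize q κs) ≡ κs
shPath-tokenize [] [] e = refl , refl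
shPath-tokenize [] (κ ∷ κs) ()
shPath-tokenize (N ∷ q) [] ()
shPath-tokenize (E ∷ q) κs e = let (p₁ , p₂) = shPath-tokenize q κs e in cong (E ∷_) p₁ , p₂
shPath-tokenize (N ∷ q) (κ ∷ κs) e =
  let (p₁ , p₂) = shPath-tokenize q κs (suc-injective e) in cong (N ∷_) p₁ , cong (κ ∷_) p₂

kindOfLabel : ℕ → Kind
kindOfLabel 1 = one
kindOfLabel _ = two

decodePF : List Step → List ℕ → List Bool → List Token
decodePF-afterPair : List Step → List ℕ → List Bool → List Token
decodePF [] ls ds = []
decodePF (E ∷ p) ls ds = east ∷ decodePF p ls ds
decodePF (N ∷ N ∷ p) (l ∷ l' ∷ ls) (d ∷ true ∷ ds) = north pair ∷ decodePF-afterPair p ls ds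
decodePF (N ∷ p) (l ∷ ls) (d ∷ ds) = north (kindOfLabel l) ∷ decodePF p ls ds
decodePF (N ∷ p) _ _ = []
decodePF-afterPair (E ∷ p) ls ds = decodePF p ls ds
decodePF-afterPair _ _ _ = []

decodePF-encode : ∀ bs → decodePF (pfPath bs) (pfLabels bs) (pfDecor bs) ≡ bs
decodePF-encode [] = refl
decodePF-encode (east ∷ bs) = cong (east ∷_) (decodePF-encode bs)
decodePF-encode (north pair ∷ bs) = cong (north pair ∷_) (decodePF-encode bs)
decodePF-encode (north one ∷ []) = refl
decodePF-encode (north one ∷ east ∷ bs) = cong (north one ∷_) (decodePF-encode (east ∷ bs))
decodePF-encode (north one ∷ north pair ∷ bs) = cong (north one ∷_) (decodePF-encode (north pair ∷ bs))
decodePF-encode (north one ∷ north one ∷ bs) = cong (north one ∷_) (decodePF-encode (north one ∷ bs))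
decodePF-encode (north one ∷ north two ∷ bs) = cong (north one ∷_) (decodePF-encode (north two ∷ bs))
decodePF-encode (north two ∷ []) = refl
decodePF-encode (north two ∷ east ∷ bs) = cong (north two ∷_) (decodePF-encode (east ∷ bs))
decodePF-encode (north two ∷ north pair ∷ bs) = cong (north two ∷_) (decodePF-encode (north pair ∷ bs))
decodePF-encode (north two ∷ north one ∷ bs) = cong (north two ∷_) (decodePF-encode (north one ∷ bs))
decodePF-encode (north two ∷ north two ∷ bs) = cong (north two ∷_) (decodePF-encode (north two ∷ bs))

pfEncoding-injective : ∀ bs bs' → pfPath bs ≡ pfPath bs' → pfLabels bs ≡ pfLabels bs' →
                       pfDecor bs ≡ pfDecor bs' → bs ≡ bs'
pfEncoding-injective bs bs' ep el ed = begin
  bs                                                   ≡⟨ sym (decodePF-encode bs) ⟩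
  decodePF (pfPath bs) (pfLabels bs) (pfDecor bs)      ≡⟨ cong₂ (λ p l → decodePF p l (pfDecor bs)) ep el ⟩
  decodePF (pfPath bs') (pfLabels bs') (pfDecor bs)    ≡⟨ cong (decodePF (pfPath bs') (pfLabels bs')) ed ⟩
  decodePF (pfPath bs') (pfLabels bs') (pfDecor bs')   ≡⟨ decodePF-encode bs' ⟩
  bs'                                                  ∎
  where open ≡-Reasoning

-- Both encodings of a token word are walks simultaneously (a pair N N E and a single N
-- both raise the height by one).
walk-pf⇒sh : ∀ h bs → Walk h (pfPath bs) → Walk h (shPath bs)
walk-pf⇒sh h [] w = w
walk-pf⇒sh zero (east ∷ bs) ()
walk-pf⇒sh (suc h) (east ∷ bs) w = walk-pf⇒sh h bs w
walk-pf⇒sh h (north pair ∷ bs) w = walk-pf⇒sh (suc h) bs w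
walk-pf⇒sh h (north one ∷ bs) w = walk-pf⇒sh (suc h) bs w
walk-pf⇒sh h (north two ∷ bs) w = walk-pf⇒sh (suc h) bs w

walk-sh⇒pf : ∀ h bs → Walk h (shPath bs) → Walk h (pfPath bs)
walk-sh⇒pf h [] w = w
walk-sh⇒pf zero (east ∷ bs) ()
walk-sh⇒pf (suc h) (east ∷ bs) w = walk-sh⇒pf h bs w
walk-sh⇒pf h (north pair ∷ bs) w = walk-sh⇒pf (suc h) bs w
walk-sh⇒pf h (north one ∷ bs) w = walk-sh⇒pf (suc h) bs w
walk-sh⇒pf h (north two ∷ bs) w = walk-sh⇒pf (suc h) bs w

length-pfLabels : ∀ bs → length (pfLabels bs) ≡ numN (pfPath bs)
length-pfLabels [] = refl
length-pfLabels (east ∷ bs) = length-pfLabels bs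
length-pfLabels (north pair ∷ bs) = cong (λ x → suc (suc x)) (length-pfLabels bs)
length-pfLabels (north one ∷ bs) = cong suc (length-pfLabels bs)
length-pfLabels (north two ∷ bs) = cong suc (length-pfLabels bs)

length-pfDecor : ∀ bs → length (pfDecor bs) ≡ numN (pfPath bs)
length-pfDecor [] = refl
length-pfDecor (east ∷ bs) = length-pfDecor bs
length-pfDecor (north pair ∷ bs) = cong (λ x → suc (suc x)) (length-pfDecor bs)
length-pfDecor (north one ∷ bs) = cong suc (length-pfDecor bs)
length-pfDecor (north two ∷ bs) = cong suc (length-pfDecor bs)

pfLabels-positive : ∀ bs → All (1 ≤_) (pfLabels bs)
pfLabels-positive [] = []
pfLabels-positive (east ∷ bs) = pfLabels-positive bs
pfLabels-positive (north pair ∷ bs) = s≤s z≤n ∷ s≤s z≤n ∷ pfLabels-positive bs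
pfLabels-positive (north one ∷ bs) = s≤s z≤n ∷ pfLabels-positive bs
pfLabels-positive (north two ∷ bs) = s≤s z≤n ∷ pfLabels-positive bs

pfLabels-1or2 : ∀ bs → All (λ l → l ≡ 1 ⊎ l ≡ 2) (pfLabels bs)
pfLabels-1or2 [] = []
pfLabels-1or2 (east ∷ bs) = pfLabels-1or2 bs
pfLabels-1or2 (north pair ∷ bs) = inj₁ refl ∷ inj₂ refl ∷ pfLabels-1or2 bs
pfLabels-1or2 (north one ∷ bs) = inj₁ refl ∷ pfLabels-1or2 bs
pfLabels-1or2 (north two ∷ bs) = inj₂ refl ∷ pfLabels-1or2 bs

Row : Set
Row = ℕ × Kind

rows : ℕ → List Token → List Row
rows h [] = []
rows h (east ∷ bs) = rows (pred h) bs
rows h (north κ ∷ bs) = (h , κ) ∷ rows (suc h) bs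

pfHeights : List Row → List ℕ
pfHeights [] = []
pfHeights ((a , pair) ∷ r) = a ∷ suc a ∷ pfHeights r
pfHeights ((a , one) ∷ r) = a ∷ pfHeights r
pfHeights ((a , two) ∷ r) = a ∷ pfHeights r

heights-shPath : ∀ h bs → heights h (shPath bs) ≡ map proj₁ (rows h bs)
heights-shPath h [] = refl
heights-shPath h (east ∷ bs) = heights-shPath (pred h) bs
heights-shPath h (north κ ∷ bs) = cong (h ∷_) (heights-shPath (suc h) bs)

heights-pfPath : ∀ h bs → heights h (pfPath bs) ≡ pfHeights (rows h bs)
heights-pfPath h [] = refl
heights-pfPath h (east ∷ bs) = heights-pfPath (pred h) bs
heights-pfPath h (north pair ∷ bs) = cong (λ x → h ∷ suc h ∷ x) (heights-pfPath (suc h) bs)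
heights-pfPath h (north one ∷ bs) = cong (h ∷_) (heights-pfPath (suc h) bs)
heights-pfPath h (north two ∷ bs) = cong (h ∷_) (heights-pfPath (suc h) bs)

kinds-rows : ∀ h bs → map proj₂ (rows h bs) ≡ kinds bs
kinds-rows h [] = refl
kinds-rows h (east ∷ bs) = kinds-rows (pred h) bs
kinds-rows h (north κ ∷ bs) = cong (κ ∷_) (kinds-rows (suc h) bs)

length-rows : ∀ h bs → length (rows h bs) ≡ numN (shPath bs)
length-rows h [] = refl
length-rows h (east ∷ bs) = length-rows (pred h) bs
length-rows h (north κ ∷ bs) = cong suc (length-rows (suc h) bs)

-- Local form of the rise condition of a decorated path: a decorated row must directly
-- follow a north step (b records whether the previous step was north).
DecorAfterNorth : Bool → List Step → List Bool → Set
DecorAfterNorth b [] ds = ⊤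
DecorAfterNorth b (E ∷ p) ds = DecorAfterNorth false p ds
DecorAfterNorth b (N ∷ p) [] = ⊤
DecorAfterNorth b (N ∷ p) (d ∷ ds) = (d ≡ true → b ≡ true) × DecorAfterNorth true p ds

DecorsAreRises : List Bool → List Bool → Set
DecorsAreRises ds fs = All (λ q → proj₁ q ≡ true → proj₂ q ≡ true) (zip ds fs)

<ᵇ-false : ∀ {a h} → h ≤ a → (a <ᵇ h) ≡ false
<ᵇ-false {a} {h} le with a <ᵇ h in eq
... | false = refl
... | true = ⊥-elim (<⇒≱ (<ᵇ⇒< a h (subst T (sym eq) tt)) le)

-- Relation between the previous height a and the current height h: after a north step
-- h = a+1; after an east step h ≤ a, so the next row cannot be a rise.
RiseInvariant : Bool → ℕ → ℕ → Set
RiseInvariant true a h = suc a ≡ h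
RiseInvariant false a h = h ≤ a

rises⇒afterNorth : ∀ b a h p ds → Walk h p → RiseInvariant b a h →
                   DecorsAreRises ds (riseAux a (heights h p)) → DecorAfterNorth b p ds
rises⇒afterNorth b a h [] ds w i r = tt
rises⇒afterNorth b a h (N ∷ p) [] w i r = tt
rises⇒afterNorth true a h (N ∷ p) (d ∷ ds) w i (r ∷ rs) =
  (λ _ → refl) , rises⇒afterNorth true h (suc h) p ds w refl rs
rises⇒afterNorth false a h (N ∷ p) (d ∷ ds) w i (r ∷ rs) =
  (λ dt → trans (sym (<ᵇ-false i)) (r dt)) , rises⇒afterNorth true h (suc h) p ds w refl rs
rises⇒afterNorth true a (suc h) (E ∷ p) ds w i r =
  rises⇒afterNorth false a h p ds w (≤-reflexive (suc-injective (sym i))) r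
rises⇒afterNorth false a (suc h) (E ∷ p) ds w i r =
  rises⇒afterNorth false a h p ds w (≤-trans (n≤1+n h) i) r

rises⇒afterNorth₀ : ∀ p ds → Walk 0 p → DecorsAreRises ds (riseFlags (heights 0 p)) →
                    DecorAfterNorth false p ds
rises⇒afterNorth₀ [] ds w r = tt
rises⇒afterNorth₀ (N ∷ p) [] w r = tt
rises⇒afterNorth₀ (N ∷ p) (d ∷ ds) w (r ∷ rs) = r , rises⇒afterNorth true 0 1 p ds w refl rs

-- Local form of ColumnIncreasing: consecutive north steps (same column) carry
-- increasing labels.  LocalColAfter l: the previous step was north with label l.
LocalCol : List Step → List ℕ → Set
LocalColAfter : ℕ → List Step → List ℕ → Set
LocalCol [] ls = ⊤
LocalCol (E ∷ p) ls = LocalCol p ls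
LocalCol (N ∷ p) [] = ⊤
LocalCol (N ∷ p) (l ∷ ls) = LocalColAfter l p ls
LocalColAfter l [] ls = ⊤
LocalColAfter l (E ∷ p) ls = LocalCol p ls
LocalColAfter l (N ∷ p) [] = ⊤
LocalColAfter l (N ∷ p) (l' ∷ ls) = l < l' × LocalColAfter l' p ls

localAfter⇒local : ∀ l p ls → LocalColAfter l p ls → LocalCol p ls
localAfter⇒local l [] ls c = tt
localAfter⇒local l (E ∷ p) ls c = c
localAfter⇒local l (N ∷ p) [] c = tt
localAfter⇒local l (N ∷ p) (l' ∷ ls) (_ , c) = c

columnsFrom : ℕ → ℕ → List Step → List ℕ
columnsFrom ns es p = map proj₁ (vertAux ns es p)

ColumnOrdered : ℕ × ℕ → ℕ × ℕ → Set
ColumnOrdered u v = proj₁ u ≡ proj₁ v → proj₂ u < proj₂ v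

colInc⇒local : ∀ ns es p ls → AllPairs ColumnOrdered (zip (columnsFrom ns es p) ls) →
               LocalCol p ls
colInc⇒localAfter : ∀ ns es l p ls → All (ColumnOrdered (es , l)) (zip (columnsFrom ns es p) ls) →
                    AllPairs ColumnOrdered (zip (columnsFrom ns es p) ls) → LocalColAfter l p ls
colInc⇒local ns es [] ls ap = tt
colInc⇒local ns es (E ∷ p) ls ap = colInc⇒local ns (suc es) p ls ap
colInc⇒local ns es (N ∷ p) [] ap = tt
colInc⇒local ns es (N ∷ p) (l ∷ ls) (a ∷ ap) = colInc⇒localAfter (suc ns) es l p ls a ap
colInc⇒localAfter ns es l [] ls a ap = tt
colInc⇒localAfter ns es l (E ∷ p) ls a ap = colInc⇒local ns (suc es) p ls ap
colInc⇒localAfter ns es l (N ∷ p) [] a ap = tt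
colInc⇒localAfter ns es l (N ∷ p) (l' ∷ ls) (r ∷ a) (a' ∷ ap) =
  r refl , colInc⇒localAfter (suc ns) es l' p ls a' ap

-- Columns never decrease, so a row after an east step is in a later column.
columnsFrom-≥ : ∀ ns es p → All (es ≤_) (columnsFrom ns es p)
columnsFrom-≥ ns es [] = []
columnsFrom-≥ ns es (N ∷ p) = ≤-refl ∷ columnsFrom-≥ (suc ns) es p
columnsFrom-≥ ns es (E ∷ p) = All.map (≤-trans (n≤1+n es)) (columnsFrom-≥ ns (suc es) p)

All-zip : ∀ {A B : Set} {P : A → Set} {Q : A × B → Set} xs ls → All P xs → (∀ {x l} → P x → Q (x , l)) →
          All Q (zip xs ls)
All-zip [] ls a f = []
All-zip (x ∷ xs) [] a f = []
All-zip (x ∷ xs) (l ∷ ls) (px ∷ a) f = f px ∷ All-zip xs ls a f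

localAfter⇒firstRow : ∀ ns es l p ls → LocalColAfter l p ls →
                      All (ColumnOrdered (es , l)) (zip (columnsFrom ns es p) ls)
localAfter⇒firstRow ns es l [] ls c = []
localAfter⇒firstRow ns es l (E ∷ p) ls c =
  All-zip (columnsFrom ns (suc es) p) ls (columnsFrom-≥ ns (suc es) p) (λ le eq → ⊥-elim (<-irrefl eq le))
localAfter⇒firstRow ns es l (N ∷ p) [] c = []
localAfter⇒firstRow ns es l (N ∷ p) (l' ∷ ls) (lt , c) =
  (λ _ → lt) ∷ All.map (λ r e → <-trans lt (r e)) (localAfter⇒firstRow (suc ns) es l' p ls c)

local⇒colInc : ∀ ns es p ls → LocalCol p ls → AllPairs ColumnOrdered (zip (columnsFrom ns es p) ls)
localAfter⇒colInc : ∀ ns es l p ls → LocalColAfter l p ls →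
                    AllPairs ColumnOrdered (zip (columnsFrom ns es p) ls)
local⇒colInc ns es [] ls c = []
local⇒colInc ns es (E ∷ p) ls c = local⇒colInc ns (suc es) p ls c
local⇒colInc ns es (N ∷ p) [] c = []
local⇒colInc ns es (N ∷ p) (l ∷ ls) c =
  localAfter⇒firstRow (suc ns) es l p ls c ∷ localAfter⇒colInc (suc ns) es l p ls c
localAfter⇒colInc ns es l [] ls c = []
localAfter⇒colInc ns es l (E ∷ p) ls c = local⇒colInc ns (suc es) p ls c
localAfter⇒colInc ns es l (N ∷ p) [] c = []
localAfter⇒colInc ns es l (N ∷ p) (l' ∷ ls) (lt , c) = local⇒colInc ns es (N ∷ p) (l' ∷ ls) c

Is1or2 : ℕ → Set
Is1or2 l = l ≡ 1 ⊎ l ≡ 2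

-- After a north step the next row may still be decorated only if it starts a pair;
-- inside parseSingle we know it is not.
NextUndecorated : List Step → List Bool → Set
NextUndecorated (N ∷ p) (true ∷ ds) = ⊥
NextUndecorated _ _ = ⊤

EncodesPF : List Step → List ℕ → List Bool → Set
EncodesPF p ls ds = Σ (List Token) λ bs → pfPath bs ≡ p × pfLabels bs ≡ ls × pfDecor bs ≡ ds

no-rising-triple : ∀ {x y z} → Is1or2 x → Is1or2 y → Is1or2 z → x < y → y < z → ⊥
no-rising-triple (inj₁ refl) (inj₁ refl) _ (s≤s ()) _
no-rising-triple (inj₁ refl) (inj₂ refl) (inj₁ refl) _ (s≤s ())
no-rising-triple (inj₁ refl) (inj₂ refl) (inj₂ refl) _ (s≤s (s≤s ()))
no-rising-triple (inj₂ refl) (inj₁ refl) _ (s≤s ()) _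
no-rising-triple (inj₂ refl) (inj₂ refl) _ (s≤s (s≤s ())) _

lower-is-1 : ∀ {x y} → Is1or2 x → Is1or2 y → x < y → 1 ≡ x
lower-is-1 (inj₁ refl) _ _ = refl
lower-is-1 (inj₂ refl) (inj₁ refl) (s≤s ())
lower-is-1 (inj₂ refl) (inj₂ refl) (s≤s (s≤s ()))

upper-is-2 : ∀ {x y} → Is1or2 x → Is1or2 y → x < y → 2 ≡ y
upper-is-2 _ (inj₂ refl) _ = refl
upper-is-2 (inj₁ refl) (inj₁ refl) (s≤s ())
upper-is-2 (inj₂ refl) (inj₁ refl) (s≤s ())

encode-single : ∀ l bs → Is1or2 l →
                pfPath (north (kindOfLabel l) ∷ bs) ≡ N ∷ pfPath bs ×
                pfLabels (north (kindOfLabel l) ∷ bs) ≡ l ∷ pfLabels bs ×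
                pfDecor (north (kindOfLabel l) ∷ bs) ≡ false ∷ pfDecor bs
encode-single .1 bs (inj₁ refl) = refl , refl , refl
encode-single .2 bs (inj₂ refl) = refl , refl , refl

parsePF : ∀ h b p ls ds → Walk h p → length ls ≡ numN p → length ds ≡ numN p → All Is1or2 ls →
          LocalCol p ls → DecorAfterNorth b p ds → (b ≡ true → NextUndecorated p ds) → EncodesPF p ls ds
parseSingle : ∀ h p l ls ds → Walk (suc h) p → length ls ≡ numN p → length ds ≡ numN p →
              All Is1or2 (l ∷ ls) → LocalColAfter l p ls → DecorAfterNorth true p ds →
              NextUndecorated p ds → EncodesPF (N ∷ p) (l ∷ ls) (false ∷ ds)
parseSingle h p l ls ds w e₁ e₂ (a ∷ as) c r nd
  with parsePF (suc h) true p ls ds w e₁ e₂ as (localAfter⇒local l p ls c) r (λ _ → nd)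
... | bs , x , y , z = let (ep , el , ed) = encode-single l bs a in
  north (kindOfLabel l) ∷ bs , trans ep (cong (N ∷_) x) , trans el (cong (l ∷_) y) , trans ed (cong (false ∷_) z)
parsePF h b [] [] [] w e₁ e₂ a c r nd = [] , refl , refl , refl
parsePF h b [] (x ∷ ls) ds w () e₂ a c r nd
parsePF h b [] [] (x ∷ ds) w e₁ () a c r nd
parsePF zero b (E ∷ p) ls ds () e₁ e₂ a c r nd
parsePF (suc h) b (E ∷ p) ls ds w e₁ e₂ a c r nd with parsePF h false p ls ds w e₁ e₂ a c r (λ ())
... | bs , x , y , z = east ∷ bs , cong (E ∷_) x , y , z
parsePF h b (N ∷ p) [] ds w () e₂ a c r nd
parsePF h b (N ∷ p) (l ∷ ls) [] w e₁ () a c r nd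
-- a decorated row right after the previous north step is excluded by nd
parsePF h b (N ∷ p) (l ∷ ls) (true ∷ ds) w e₁ e₂ a c (r , _) nd with r refl
... | refl = ⊥-elim (nd refl)
-- an undecorated row followed by a decorated one: a pair, which must be closed by E
parsePF h b (N ∷ N ∷ []) (l ∷ l' ∷ ls) (false ∷ true ∷ ds) () e₁ e₂ a c r nd
parsePF h b (N ∷ N ∷ N ∷ p) (l ∷ l' ∷ []) (false ∷ true ∷ ds) w () e₂ a c r nd
parsePF h b (N ∷ N ∷ N ∷ p) (l ∷ l' ∷ l'' ∷ ls) (false ∷ true ∷ ds) w e₁ e₂ (a ∷ a' ∷ a'' ∷ _) (lt , lt' , _) r nd =
  ⊥-elim (no-rising-triple a a' a'' lt lt')
parsePF h b (N ∷ N ∷ E ∷ p) (l ∷ l' ∷ ls) (false ∷ true ∷ ds) w e₁ e₂ (a ∷ a' ∷ as) (lt , c) (_ , _ , r) nd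
  with parsePF (suc h) false p ls ds w (suc-injective (suc-injective e₁)) (suc-injective (suc-injective e₂)) as c r (λ ())
... | bs , x , y , z =
  north pair ∷ bs , cong (λ q → N ∷ N ∷ E ∷ q) x ,
  cong₂ _∷_ (lower-is-1 a a' lt) (cong₂ _∷_ (upper-is-2 a a' lt) y) , cong (λ q → false ∷ true ∷ q) z
parsePF h b (N ∷ []) (l ∷ ls) (false ∷ ds) w e₁ e₂ a c (_ , r) nd =
  parseSingle h [] l ls ds w (suc-injective e₁) (suc-injective e₂) a c r tt
parsePF h b (N ∷ E ∷ p) (l ∷ ls) (false ∷ ds) w e₁ e₂ a c (_ , r) nd =
  parseSingle h (E ∷ p) l ls ds w (suc-injective e₁) (suc-injective e₂) a c r tt
parsePF h b (N ∷ N ∷ p) (l ∷ ls) (false ∷ []) w e₁ e₂ a c (_ , r) nd =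
  parseSingle h (N ∷ p) l ls [] w (suc-injective e₁) (suc-injective e₂) a c r tt
parsePF h b (N ∷ N ∷ p) (l ∷ ls) (false ∷ false ∷ ds) w e₁ e₂ a c (_ , r) nd =
  parseSingle h (N ∷ p) l ls (false ∷ ds) w (suc-injective e₁) (suc-injective e₂) a c r tt

-- Which kinds may stand directly on top of each other in the collapsed path: after a
-- pair anything, after a one only a two, after a two nothing (labels increase upwards).
CanStack : Kind → Kind → Set
CanStack pair _ = ⊤
CanStack one two = ⊤
CanStack _ _ = ⊥

StackOK : Kind → List Token → Set
StackOK κ [] = ⊤
StackOK κ (east ∷ _) = ⊤
StackOK κ (north κ' ∷ _) = CanStack κ κ'

stackOK-pair : ∀ bs → StackOK pair bs
stackOK-pair [] = tt
stackOK-pair (east ∷ bs) = tt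
stackOK-pair (north κ ∷ bs) = tt

LocalKinds : List Token → Set
LocalKinds [] = ⊤
LocalKinds (east ∷ bs) = LocalKinds bs
LocalKinds (north κ ∷ bs) = StackOK κ bs × LocalKinds bs

local⇒localKinds : ∀ bs → LocalCol (pfPath bs) (pfLabels bs) → LocalKinds bs
local⇒localKinds [] c = tt
local⇒localKinds (east ∷ bs) c = local⇒localKinds bs c
local⇒localKinds (north pair ∷ bs) (_ , c) = stackOK-pair bs , local⇒localKinds bs c
local⇒localKinds (north one ∷ []) c = tt , tt
local⇒localKinds (north one ∷ east ∷ bs) c = tt , local⇒localKinds bs c
local⇒localKinds (north one ∷ north pair ∷ bs) (s≤s () , c)
local⇒localKinds (north one ∷ north one ∷ bs) (s≤s () , c)
local⇒localKinds (north one ∷ north two ∷ bs) (_ , c) = tt , local⇒localKinds (north two ∷ bs) c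
local⇒localKinds (north two ∷ []) c = tt , tt
local⇒localKinds (north two ∷ east ∷ bs) c = tt , local⇒localKinds bs c
local⇒localKinds (north two ∷ north pair ∷ bs) (s≤s () , c)
local⇒localKinds (north two ∷ north one ∷ bs) (s≤s () , c)
local⇒localKinds (north two ∷ north two ∷ bs) (s≤s (s≤s ()) , c)

localKinds⇒local : ∀ bs → LocalKinds bs → LocalCol (pfPath bs) (pfLabels bs)
localKinds⇒local [] _ = tt
localKinds⇒local (east ∷ bs) c = localKinds⇒local bs c
localKinds⇒local (north pair ∷ bs) (_ , c) = s≤s (s≤s z≤n) , localKinds⇒local bs c
localKinds⇒local (north one ∷ []) c = tt
localKinds⇒local (north one ∷ east ∷ bs) (_ , c) = localKinds⇒local bs c
localKinds⇒local (north one ∷ north two ∷ bs) (_ , c) = s≤s (s≤s z≤n) , localKinds⇒local (north two ∷ bs) c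
localKinds⇒local (north two ∷ []) c = tt
localKinds⇒local (north two ∷ east ∷ bs) (_ , c) = localKinds⇒local bs c
localKinds⇒local (north one ∷ north pair ∷ bs) (() , c)
localKinds⇒local (north one ∷ north one ∷ bs) (() , c)
localKinds⇒local (north two ∷ north κ ∷ bs) (() , c)

countᵇ : ∀ {A : Set} → (A → Bool) → List A → ℕ
countᵇ P xs = length (filterᵇ P xs)

countᵇ-++ : ∀ {A : Set} (P : A → Bool) xs ys → countᵇ P (xs ++ ys) ≡ countᵇ P xs + countᵇ P ys
countᵇ-++ P xs ys = trans (cong length (filter-++ (T? ∘ P) xs ys)) (length-++ (filterᵇ P xs))

countᵇ-accept : ∀ {A : Set} (P : A → Bool) x xs → T (P x) → countᵇ P (x ∷ xs) ≡ suc (countᵇ P xs)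
countᵇ-accept P x xs t = cong length (filter-accept (T? ∘ P) t)

countᵇ-reject : ∀ {A : Set} (P : A → Bool) x xs → ¬ T (P x) → countᵇ P (x ∷ xs) ≡ countᵇ P xs
countᵇ-reject P x xs t = cong length (filter-reject (T? ∘ P) t)

countᵇ-mono : ∀ {A : Set} {P Q : A → Bool} → (∀ x → T (P x) → T (Q x)) → ∀ xs → countᵇ P xs ≤ countᵇ Q xs
countᵇ-mono f [] = z≤n
countᵇ-mono {P = P} {Q} f (x ∷ xs) with P x in eq | Q x in eq'
... | true | true = s≤s (countᵇ-mono f xs)
... | false | true = m≤n⇒m≤1+n (countᵇ-mono f xs)
... | false | false = countᵇ-mono f xs
... | true | false = ⊥-elim (subst T eq' (f x (subst T (sym eq) tt)))

countᵇ-↭ : ∀ {A : Set} (P : A → Bool) {xs ys} → xs ↭ ys → countᵇ P xs ≡ countᵇ P ys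
countᵇ-↭ P p = ↭-length (filter-↭ (T? ∘ P) p)

countᵇ-map : ∀ {A B : Set} (P : B → Bool) (f : A → B) xs → countᵇ P (map f xs) ≡ countᵇ (P ∘ f) xs
countᵇ-map P f [] = refl
countᵇ-map P f (x ∷ xs) with P (f x)
... | true = cong suc (countᵇ-map P f xs)
... | false = countᵇ-map P f xs

countᵇ-local : ∀ {A : Set} (P Q : A → Bool) xs → All (λ x → P x ≡ Q x) xs → countᵇ P xs ≡ countᵇ Q xs
countᵇ-local P Q [] _ = refl
countᵇ-local P Q (x ∷ xs) (e ∷ es) with P x | Q x | e
... | true | true | _ = cong suc (countᵇ-local P Q xs es)
... | false | false | _ = countᵇ-local P Q xs es

sameKind : Kind → Kind → Bool
sameKind pair pair = true
sameKind one one = true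
sameKind two two = true
sameKind _ _ = false

sameKind-refl : ∀ κ → T (sameKind κ κ)
sameKind-refl pair = tt
sameKind-refl one = tt
sameKind-refl two = tt

sameKind-sound : ∀ κ κ' → T (sameKind κ κ') → κ ≡ κ'
sameKind-sound pair pair _ = refl
sameKind-sound one one _ = refl
sameKind-sound two two _ = refl

#kind : Kind → List Token → ℕ
#kind κ bs = countᵇ (λ κ' → sameKind κ' κ) (kinds bs)

size-pfPath : ∀ bs → numN (pfPath bs) ≡ numN (shPath bs) + #kind pair bs
size-pfPath [] = refl
size-pfPath (east ∷ bs) = size-pfPath bs
size-pfPath (north pair ∷ bs) = cong suc (trans (cong suc (size-pfPath bs)) (sym (+-suc _ _)))
size-pfPath (north one ∷ bs) = cong suc (size-pfPath bs)
size-pfPath (north two ∷ bs) = cong suc (size-pfPath bs)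

#decor : ∀ bs → countTrue (pfDecor bs) ≡ #kind pair bs
#decor [] = refl
#decor (east ∷ bs) = #decor bs
#decor (north pair ∷ bs) = cong suc (#decor bs)
#decor (north one ∷ bs) = #decor bs
#decor (north two ∷ bs) = #decor bs

#ones : ∀ bs → countEq 1 (pfLabels bs) ≡ #kind pair bs + #kind one bs
#ones [] = refl
#ones (east ∷ bs) = #ones bs
#ones (north pair ∷ bs) = cong suc (#ones bs)
#ones (north one ∷ bs) = trans (cong suc (#ones bs)) (sym (+-suc _ _))
#ones (north two ∷ bs) = #ones bs

#twos : ∀ bs → countEq 2 (pfLabels bs) ≡ #kind pair bs + #kind two bs
#twos [] = refl
#twos (east ∷ bs) = #twos bs
#twos (north pair ∷ bs) = cong suc (#twos bs)
#twos (north one ∷ bs) = #twos bs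
#twos (north two ∷ bs) = trans (cong suc (#twos bs)) (sym (+-suc _ _))

ofKind : Kind → Row → Bool
ofKind κ (a , κ') = sameKind κ' κ

#kind-rows : ∀ κ h bs → countᵇ (ofKind κ) (rows h bs) ≡ #kind κ bs
#kind-rows κ h [] = refl
#kind-rows κ h (east ∷ bs) = #kind-rows κ (pred h) bs
#kind-rows κ h (north κ' ∷ bs) with sameKind κ' κ
... | true = cong suc (#kind-rows κ (suc h) bs)
... | false = #kind-rows κ (suc h) bs

-- Reading order on rows: row x precedes row y if it lies on a lower diagonal, or on the
-- same diagonal and earlier.  The rank of a row of kind κ at height a, with pre before
-- and post after it, is the number of rows of kind κ preceding it in reading order.
ofKindAtMost : Kind → ℕ → Row → Bool
ofKindAtMost κ a r = ofKind κ r ∧ (proj₁ r ≤ᵇ a)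

ofKindBelow : Kind → ℕ → Row → Bool
ofKindBelow κ a r = ofKind κ r ∧ (proj₁ r <ᵇ a)

rank : Kind → ℕ → List Row → List Row → ℕ
rank κ a pre post = countᵇ (ofKindAtMost κ a) pre + countᵇ (ofKindBelow κ a) post

below⇒atMost : ∀ κ {a} r → T (ofKindBelow κ a r) → T (ofKindAtMost κ a r)
below⇒atMost κ {a} (b , κ') t with sameKind κ' κ
... | true = ≤⇒≤ᵇ (<⇒≤ (<ᵇ⇒< b a t))

atMost-mono : ∀ κ {a a'} → a ≤ a' → ∀ r → T (ofKindAtMost κ a r) → T (ofKindAtMost κ a' r)
atMost-mono κ {a} le (b , κ') t with sameKind κ' κ
... | true = ≤⇒≤ᵇ (≤-trans (≤ᵇ⇒≤ b a t) le)

below-mono : ∀ κ {a a'} → a ≤ a' → ∀ r → T (ofKindBelow κ a r) → T (ofKindBelow κ a' r)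
below-mono κ {a} le (b , κ') t with sameKind κ' κ
... | true = <⇒<ᵇ (<-≤-trans (<ᵇ⇒< b a t) le)

atMost⇒below : ∀ κ {a a'} → a' < a → ∀ r → T (ofKindAtMost κ a' r) → T (ofKindBelow κ a r)
atMost⇒below κ {a} {a'} lt (b , κ') t with sameKind κ' κ
... | true = <⇒<ᵇ (≤-<-trans (≤ᵇ⇒≤ b a' t) lt)

atMost⇒ofKind : ∀ κ {a} r → T (ofKindAtMost κ a r) → T (ofKind κ r)
atMost⇒ofKind κ (b , κ') t with sameKind κ' κ
... | true = tt

below⇒ofKind : ∀ κ {a} r → T (ofKindBelow κ a r) → T (ofKind κ r)
below⇒ofKind κ (b , κ') t with sameKind κ' κ
... | true = tt

atMost-self : ∀ κ {a a'} → a ≤ a' → T (ofKindAtMost κ a' (a , κ))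
atMost-self κ le with sameKind κ κ | sameKind-refl κ
... | true | _ = ≤⇒≤ᵇ le

atMost-self-false : ∀ κ {a a'} → a' < a → ¬ T (ofKindAtMost κ a' (a , κ))
atMost-self-false κ {a} {a'} lt t = <⇒≱ lt (≤ᵇ⇒≤ a a' (proj₂ (Equivalence.to T-∧ t)))

below-self : ∀ κ {a a'} → a' < a → T (ofKindBelow κ a (a' , κ))
below-self κ lt with sameKind κ κ | sameKind-refl κ
... | true | _ = <⇒<ᵇ lt

below-self-false : ∀ κ {a a'} → a ≤ a' → ¬ T (ofKindBelow κ a (a' , κ))
below-self-false κ {a} {a'} le t = <⇒≱ (<ᵇ⇒< a' a (proj₂ (Equivalence.to T-∧ t))) le

rank<total : ∀ κ a P Q → rank κ a P Q < countᵇ (ofKind κ) (P ++ (a , κ) ∷ Q)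
rank<total κ a P Q = begin-strict
  countᵇ (ofKindAtMost κ a) P + countᵇ (ofKindBelow κ a) Q
    <⟨ +-mono-≤-< (countᵇ-mono (atMost⇒ofKind κ {a}) P) (s≤s (countᵇ-mono (below⇒ofKind κ {a}) Q)) ⟩
  countᵇ (ofKind κ) P + suc (countᵇ (ofKind κ) Q)
    ≡⟨ cong (countᵇ (ofKind κ) P +_) (sym (countᵇ-accept (ofKind κ) (a , κ) Q (sameKind-refl κ))) ⟩
  countᵇ (ofKind κ) P + countᵇ (ofKind κ) ((a , κ) ∷ Q)
    ≡⟨ sym (countᵇ-++ (ofKind κ) P _) ⟩
  countᵇ (ofKind κ) (P ++ (a , κ) ∷ Q) ∎
  where open ≤-Reasoning

-- Of two rows x = (a,κ) before y = (a',κ) (with mid between them), x has the smaller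
-- rank iff it precedes y in reading order, i.e. iff a ≤ a'.
rank-forward : ∀ κ a a' P mid Q → a ≤ a' →
               rank κ a P (mid ++ (a' , κ) ∷ Q) < rank κ a' (P ++ (a , κ) ∷ mid) Q
rank-forward κ a a' P mid Q le = begin-strict
  ≤a P + <a (mid ++ (a' , κ) ∷ Q)
    ≡⟨ cong (≤a P +_) (trans (countᵇ-++ (ofKindBelow κ a) mid _)
                             (cong (<a mid +_) (countᵇ-reject (ofKindBelow κ a) (a' , κ) Q (below-self-false κ le)))) ⟩
  ≤a P + (<a mid + <a Q)
    ≡⟨ sym (+-assoc (≤a P) _ _) ⟩
  ≤a P + <a mid + <a Q
    <⟨ s≤s (+-mono-≤ (+-mono-≤ (countᵇ-mono (atMost-mono κ le) P)
                               (countᵇ-mono (λ r t → atMost-mono κ le r (below⇒atMost κ r t)) mid))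
                     (countᵇ-mono (below-mono κ le) Q)) ⟩
  suc (≤a' P + ≤a' mid + <a' Q)
    ≡⟨ cong (_+ <a' Q) (sym (+-suc (≤a' P) (≤a' mid))) ⟩
  ≤a' P + suc (≤a' mid) + <a' Q
    ≡⟨ cong (λ u → ≤a' P + u + <a' Q) (sym (countᵇ-accept (ofKindAtMost κ a') (a , κ) mid (atMost-self κ le))) ⟩
  ≤a' P + ≤a' ((a , κ) ∷ mid) + <a' Q
    ≡⟨ cong (_+ <a' Q) (sym (countᵇ-++ (ofKindAtMost κ a') P ((a , κ) ∷ mid))) ⟩
  ≤a' (P ++ (a , κ) ∷ mid) + <a' Q ∎
  where
  open ≤-Reasoning
  ≤a ≤a' <a <a' : List Row → ℕ
  ≤a = countᵇ (ofKindAtMost κ a)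
  ≤a' = countᵇ (ofKindAtMost κ a')
  <a = countᵇ (ofKindBelow κ a)
  <a' = countᵇ (ofKindBelow κ a')

rank-backward : ∀ κ a a' P mid Q → a' < a →
                rank κ a' (P ++ (a , κ) ∷ mid) Q < rank κ a P (mid ++ (a' , κ) ∷ Q)
rank-backward κ a a' P mid Q lt = begin-strict
  ≤a' (P ++ (a , κ) ∷ mid) + <a' Q
    ≡⟨ cong (_+ <a' Q) (trans (countᵇ-++ (ofKindAtMost κ a') P _)
                              (cong (≤a' P +_) (countᵇ-reject (ofKindAtMost κ a') (a , κ) mid (atMost-self-false κ lt)))) ⟩
  ≤a' P + ≤a' mid + <a' Q
    <⟨ +-mono-≤-< (+-mono-≤ (countᵇ-mono (atMost-mono κ (<⇒≤ lt)) P) (countᵇ-mono (atMost⇒below κ lt) mid))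
                  (s≤s (countᵇ-mono (below-mono κ (<⇒≤ lt)) Q)) ⟩
  ≤a P + <a mid + suc (<a Q)
    ≡⟨ +-assoc (≤a P) _ _ ⟩
  ≤a P + (<a mid + suc (<a Q))
    ≡⟨ cong (≤a P +_) (trans (cong (<a mid +_) (sym (countᵇ-accept (ofKindBelow κ a) (a' , κ) Q (below-self κ lt))))
                             (sym (countᵇ-++ (ofKindBelow κ a) mid _))) ⟩
  ≤a P + <a (mid ++ (a' , κ) ∷ Q) ∎
  where
  open ≤-Reasoning
  ≤a ≤a' <a <a' : List Row → ℕ
  ≤a = countᵇ (ofKindAtMost κ a)
  ≤a' = countᵇ (ofKindAtMost κ a')
  <a = countᵇ (ofKindBelow κ a)
  <a' = countᵇ (ofKindBelow κ a')

mapWithContext : ∀ {A B : Set} → (List A → A → List A → B) → List A → List A → List B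
mapWithContext f pre [] = []
mapWithContext f pre (x ∷ xs) = f pre x xs ∷ mapWithContext f (pre ++ x ∷ []) xs

length-mapWithContext : ∀ {A B : Set} (f : List A → A → List A → B) pre xs →
                        length (mapWithContext f pre xs) ≡ length xs
length-mapWithContext f pre [] = refl
length-mapWithContext f pre (x ∷ xs) = cong suc (length-mapWithContext f (pre ++ x ∷ []) xs)

mapWithContext-All : ∀ {A B : Set} (f : List A → A → List A → B) (R : A × B → Set) (whole : List A) →
  (∀ pre x post → pre ++ x ∷ post ≡ whole → R (x , f pre x post)) →
  ∀ pre xs → pre ++ xs ≡ whole → All R (zip xs (mapWithContext f pre xs))
mapWithContext-All f R whole h pre [] e = []
mapWithContext-All f R whole h pre (x ∷ xs) e =
  h pre x xs e ∷ mapWithContext-All f R whole h (pre ++ x ∷ []) xs (trans (++-assoc pre (x ∷ []) xs) e)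

mapWithContext-AllPairs : ∀ {A B : Set} (f : List A → A → List A → B) (Q : A × B → A × B → Set) (whole : List A) →
  (∀ pre mid x y post → pre ++ x ∷ mid ++ y ∷ post ≡ whole →
     Q (x , f pre x (mid ++ y ∷ post)) (y , f (pre ++ x ∷ mid) y post)) →
  ∀ pre xs → pre ++ xs ≡ whole → AllPairs Q (zip xs (mapWithContext f pre xs))
mapWithContext-AllPairs f Q whole h pre [] e = []
mapWithContext-AllPairs f Q whole h pre (x ∷ xs) e =
  later [] xs e ∷ mapWithContext-AllPairs f Q whole h (pre ++ x ∷ []) xs (trans (++-assoc pre (x ∷ []) xs) e)
  where
  later : ∀ mid ys → pre ++ x ∷ mid ++ ys ≡ whole →
          All (Q (x , f pre x (mid ++ ys))) (zip ys (mapWithContext f (pre ++ x ∷ mid) ys))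
  later mid [] e' = []
  later mid (y ∷ ys) e' =
    h pre mid x y ys e'
    ∷ subst₂ (λ u v → All (Q (x , f pre x u)) (zip ys (mapWithContext f v ys)))
             (++-assoc mid (y ∷ []) ys) (sym (++-assoc pre (x ∷ mid) (y ∷ [])))
             (later (mid ++ y ∷ []) ys (trans (cong (λ u → pre ++ x ∷ u) (++-assoc mid (y ∷ []) ys)) e'))

blockLabel : ℕ → ℕ → Kind → ℕ → ℕ
blockLabel n s pair r = suc r
blockLabel n s one r = n ∸ r
blockLabel n s two r = s ∸ r

standardLabel : ℕ → ℕ → List Row → Row → List Row → ℕ
standardLabel n s pre (a , κ) post = blockLabel n s κ (rank κ a pre post)

standardise : ℕ → ℕ → List Row → List ℕ
standardise n s xs = mapWithContext (standardLabel n s) [] xs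

InBlock : ℕ → ℕ → ℕ → Kind → ℕ → Set
InBlock k n s pair l = 1 ≤ l × l ≤ k
InBlock k n s one l = k < l × l ≤ n
InBlock k n s two l = n < l × l ≤ s

RowInBlock : ℕ → ℕ → ℕ → Row × ℕ → Set
RowInBlock k n s ((a , κ) , l) = InBlock k n s κ l

KindOrder : Kind → ℕ → ℕ → Set
KindOrder pair l l' = l < l'
KindOrder one l l' = l' < l
KindOrder two l l' = l' < l

LabelOrder : Kind → ℕ → ℕ → ℕ → ℕ → Set
LabelOrder κ a a' l l' = (a ≤ a' → KindOrder κ l l') × (a' < a → KindOrder κ l' l)

StdPair : Row × ℕ → Row × ℕ → Set
StdPair ((a , κ) , l) ((a' , κ') , l') = κ ≡ κ' → LabelOrder κ a a' l l'

record KindTotals (k n s : ℕ) (whole : List Row) : Set where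
  field
    #pair≡ : countᵇ (ofKind pair) whole ≡ k
    #one+k≡ : countᵇ (ofKind one) whole + k ≡ n
    #two+n≡ : countᵇ (ofKind two) whole + n ≡ s

descending-inBlock : ∀ {r c b t} → r < c → c + b ≡ t → b < t ∸ r × t ∸ r ≤ t
descending-inBlock {r} {c} {b} {t} r<c eq =
  m+n≤o⇒m≤o∸n (suc b) (subst (suc b + r ≤_) (trans (+-comm b c) eq) (+-monoʳ-< b r<c)) , m∸n≤m t r

module Standardisation (k n s : ℕ) (whole : List Row) (tots : KindTotals k n s whole) where
  open KindTotals tots

  rank<count : ∀ pre a κ post → pre ++ (a , κ) ∷ post ≡ whole → rank κ a pre post < countᵇ (ofKind κ) whole
  rank<count pre a κ post e = subst (λ u → rank κ a pre post < countᵇ (ofKind κ) u) e (rank<total κ a pre post)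

  inBlock-at : ∀ pre x post → pre ++ x ∷ post ≡ whole → RowInBlock k n s (x , standardLabel n s pre x post)
  inBlock-at pre (a , pair) post e = s≤s z≤n , subst (rank pair a pre post <_) #pair≡ (rank<count pre a pair post e)
  inBlock-at pre (a , one) post e = descending-inBlock (rank<count pre a one post e) #one+k≡
  inBlock-at pre (a , two) post e = descending-inBlock (rank<count pre a two post e) #two+n≡

  standardise-inBlock : All (RowInBlock k n s) (zip whole (standardise n s whole))
  standardise-inBlock = mapWithContext-All (standardLabel n s) (RowInBlock k n s) whole inBlock-at [] whole refl

  stdPair-at : ∀ pre mid x y post → pre ++ x ∷ mid ++ y ∷ post ≡ whole →
               StdPair (x , standardLabel n s pre x (mid ++ y ∷ post)) (y , standardLabel n s (pre ++ x ∷ mid) y post)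
  stdPair-at pre mid (a , κ) (a' , .κ) post e refl =
    order κ (rank-forward κ a a' pre mid post) (rank-backward κ a a' pre mid post)
          (rank<count pre a κ (mid ++ (a' , κ) ∷ post) e)
          (rank<count (pre ++ (a , κ) ∷ mid) a' κ post (trans (++-assoc pre ((a , κ) ∷ mid) _) e))
    where
    descending : ∀ {r r' c t} → (a ≤ a' → r < r') → (a' < a → r' < r) → r < c → r' < c → c ≤ t →
                 (a ≤ a' → t ∸ r' < t ∸ r) × (a' < a → t ∸ r < t ∸ r')
    descending fw bw r<c r'<c c≤t = (λ le → ∸-monoʳ-< (fw le) (≤-trans (<⇒≤ r'<c) c≤t))
                                  , (λ lt → ∸-monoʳ-< (bw lt) (≤-trans (<⇒≤ r<c) c≤t))
    order : ∀ κ {r r'} → (a ≤ a' → r < r') → (a' < a → r' < r) →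
            r < countᵇ (ofKind κ) whole → r' < countᵇ (ofKind κ) whole →
            LabelOrder κ a a' (blockLabel n s κ r) (blockLabel n s κ r')
    order pair fw bw _ _ = s≤s ∘ fw , s≤s ∘ bw
    order one fw bw r<c r'<c = descending fw bw r<c r'<c (subst (_ ≤_) #one+k≡ (m≤m+n _ k))
    order two fw bw r<c r'<c = descending fw bw r<c r'<c (subst (_ ≤_) #two+n≡ (m≤m+n _ n))

  standardise-stdPair : AllPairs StdPair (zip whole (standardise n s whole))
  standardise-stdPair = mapWithContext-AllPairs (standardLabel n s) StdPair whole stdPair-at [] whole refl

AllPairs-with : ∀ {A : Set} {P : A → Set} {R S : A → A → Set} →
                (∀ {x y} → P x → P y → R x y → S x y) → ∀ {xs} → All P xs → AllPairs R xs → AllPairs S xs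
AllPairs-with f [] [] = []
AllPairs-with f (px ∷ pxs) (rx ∷ rxs) =
  All.zipWith (λ { (py , r) → f px py r }) (pxs , rx) ∷ AllPairs-with f pxs rxs

onDiagonal : ∀ {A : Set} → (A → ℕ) → List A → ℕ → List A
onDiagonal α zs d = filterᵇ (λ z → α z ≡ᵇ d) zs

readingOrder : ∀ {A : Set} → (A → ℕ) → ℕ → List A → List A
readingOrder α L zs = concatMap (onDiagonal α zs) (upTo L)

onDiagonal-height : ∀ {A : Set} (α : A → ℕ) zs d → All (λ z → α z ≡ d) (onDiagonal α zs d)
onDiagonal-height α zs d = All.map (λ {z} → ≡ᵇ⇒≡ (α z) d) (Allₚ.all-filter (T? ∘ λ z → α z ≡ᵇ d) zs)

readingOrder-All : ∀ {A : Set} {P : A → Set} (α : A → ℕ) {zs} → All P zs → ∀ ds →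
                   All P (concatMap (onDiagonal α zs) ds)
readingOrder-All α pzs ds =
  Allₚ.concat⁺ (Allₚ.map⁺ (All.universal (λ d → Allₚ.filter⁺ (T? ∘ λ z → α z ≡ᵇ d) pzs) ds))

filter-disjoint-↭ : ∀ {A : Set} (P Q R : A → Bool) → (∀ x → R x ≡ (P x ∨ Q x)) →
                    (∀ x → T (P x) → ¬ T (Q x)) → ∀ xs → filterᵇ P xs ++ filterᵇ Q xs ↭ filterᵇ R xs
filter-disjoint-↭ P Q R e d [] = ↭-refl
filter-disjoint-↭ P Q R e d (x ∷ xs) with P x in ep | Q x in eq | R x | e x
... | true | true | _ | _ = ⊥-elim (d x (subst T (sym ep) tt) (subst T (sym eq) tt))
... | true | false | true | _ = ↭-prep x (filter-disjoint-↭ P Q R e d xs)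
... | false | true | true | _ =
  ↭-trans (shift x (filterᵇ P xs) (filterᵇ Q xs)) (↭-prep x (filter-disjoint-↭ P Q R e d xs))
... | false | false | false | _ = filter-disjoint-↭ P Q R e d xs

<ᵇ-suc : ∀ a L → (a <ᵇ suc L) ≡ ((a <ᵇ L) ∨ (a ≡ᵇ L))
<ᵇ-suc zero zero = refl
<ᵇ-suc zero (suc L) = refl
<ᵇ-suc (suc zero) zero = refl
<ᵇ-suc (suc (suc a)) zero = refl
<ᵇ-suc (suc a) (suc L) = <ᵇ-suc a L

readingOrder-↭below : ∀ {A : Set} (α : A → ℕ) L zs → readingOrder α L zs ↭ filterᵇ (λ z → α z <ᵇ L) zs
readingOrder-↭below α zero zs =
  subst ([] ↭_) (sym (filter-none (T? ∘ λ z → α z <ᵇ 0) (All.universal (λ _ ()) zs))) ↭-refl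
readingOrder-↭below α (suc L) zs = begin
  readingOrder α (suc L) zs                                              ≡⟨ unfold ⟩
  readingOrder α L zs ++ onDiagonal α zs L                               ↭⟨ ++⁺ʳ _ (readingOrder-↭below α L zs) ⟩
  filterᵇ (λ z → α z <ᵇ L) zs ++ onDiagonal α zs L                       ↭⟨ split ⟩
  filterᵇ (λ z → α z <ᵇ suc L) zs                                        ∎
  where
  open PermutationReasoning
  unfold : readingOrder α (suc L) zs ≡ readingOrder α L zs ++ onDiagonal α zs L
  unfold = trans (cong (concatMap (onDiagonal α zs)) (sym (applyUpTo-∷ʳ id L)))
                 (trans (concatMap-++ (onDiagonal α zs) (upTo L) (L ∷ [])) (cong (readingOrder α L zs ++_) (++-identityʳ _)))
  split = filter-disjoint-↭ (λ z → α z <ᵇ L) (λ z → α z ≡ᵇ L) _ (λ z → <ᵇ-suc (α z) L)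
            (λ z t₁ t₂ → <-irrefl (≡ᵇ⇒≡ (α z) L t₂) (<ᵇ⇒< (α z) L t₁)) zs

readingOrder-↭ : ∀ {A : Set} (α : A → ℕ) L zs → All (λ z → α z < L) zs → readingOrder α L zs ↭ zs
readingOrder-↭ α L zs below =
  subst (readingOrder α L zs ↭_) (filter-all (T? ∘ λ z → α z <ᵇ L) (All.map <⇒<ᵇ below)) (readingOrder-↭below α L zs)

module _ {A : Set} (α : A → ℕ) {R S : A → A → Set}
         (orient : ∀ {x y} → R x y → (α x ≤ α y → S x y) × (α y < α x → S y x)) where

  ascending : ∀ zs → AllPairs R zs → All (λ x → All (λ y → α x < α y → S x y) zs) zs
  ascending [] _ = []
  ascending (z ∷ zs) (rz ∷ rzs) =
    ((λ lt → ⊥-elim (<-irrefl refl lt)) ∷ All.map (λ r lt → proj₁ (orient r) (<⇒≤ lt)) rz)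
    ∷ All.zipWith (λ { (r , q) → (λ lt → proj₂ (orient r) lt) ∷ q }) (rz , ascending zs rzs)

  onDiagonal-AllPairs : ∀ zs d → AllPairs R zs → AllPairs S (onDiagonal α zs d)
  onDiagonal-AllPairs zs d rzs =
    AllPairs-with (λ αx≡d αy≡d r → proj₁ (orient r) (≤-reflexive (trans αx≡d (sym αy≡d))))
                  (onDiagonal-height α zs d) (AllPairsₚ.filter⁺ (T? ∘ λ z → α z ≡ᵇ d) rzs)

  readingOrder-AllPairs : ∀ L zs → AllPairs R zs → AllPairs S (readingOrder α L zs)
  readingOrder-AllPairs L zs rzs = sorted (upTo L) (AllPairsₚ.applyUpTo⁺₁ id L (λ i<j _ → i<j))
    where
    sorted : ∀ ds → AllPairs _<_ ds → AllPairs S (concatMap (onDiagonal α zs) ds)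
    sorted [] _ = []
    sorted (d ∷ ds) (d<ds ∷ ds-sorted) =
      AllPairsₚ.++⁺ (onDiagonal-AllPairs zs d rzs) (sorted ds ds-sorted) cross
      where
      later : All (λ y → d < α y) (concatMap (onDiagonal α zs) ds)
      later = Allₚ.concat⁺ (Allₚ.map⁺ (All.map (λ {e} d<e → All.map (λ αy≡e → subst (d <_) (sym αy≡e) d<e)
                                                                     (onDiagonal-height α zs e)) d<ds))
      cross : All (λ x → All (S x) (concatMap (onDiagonal α zs) ds)) (onDiagonal α zs d)
      cross = All.zipWith
        (λ { (asc , αx≡d) → All.zipWith (λ { (f , d<αy) → f (subst (_< _) (sym αx≡d) d<αy) })
                                         (readingOrder-All α asc ds , later) })
        (Allₚ.filter⁺ (T? ∘ λ z → α z ≡ᵇ d) (ascending zs rzs) , onDiagonal-height α zs d)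

labelsOnDiag-map : ∀ {A : Set} (α β : A → ℕ) d zs →
                   labelsOnDiag d (map (λ z → (α z , β z)) zs) ≡ map β (onDiagonal α zs d)
labelsOnDiag-map α β d [] = refl
labelsOnDiag-map α β d (z ∷ zs) with α z ≡ᵇ d
... | true = cong (β z ∷_) (labelsOnDiag-map α β d zs)
... | false = labelsOnDiag-map α β d zs

readingWord≡readingOrder : ∀ {A : Set} (α β : A → ℕ) L zs →
  concatMap (λ d → labelsOnDiag d (map (λ z → (α z , β z)) zs)) (upTo L) ≡ map β (readingOrder α L zs)
readingWord≡readingOrder α β L zs =
  trans (concatMap-cong (λ d → labelsOnDiag-map α β d zs) (upTo L))
        (sym (map-concatMap β (onDiagonal α zs) (upTo L)))

increasing-length : ∀ xs lo hi → lo ≤ hi → AllPairs _<_ xs → All (lo ≤_) xs → All (_< hi) xs →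
                    length xs + lo ≤ hi
increasing-length [] lo hi lo≤hi _ _ _ = lo≤hi
increasing-length (x ∷ xs) lo hi lo≤hi (x<xs ∷ sorted) (lo≤x ∷ _) (x<hi ∷ xs<hi) = begin
  suc (length xs + lo) ≤⟨ s≤s (+-monoʳ-≤ (length xs) lo≤x) ⟩
  suc (length xs + x)  ≡⟨ sym (+-suc (length xs) x) ⟩
  length xs + suc x    ≤⟨ increasing-length xs (suc x) hi x<hi sorted x<xs xs<hi ⟩
  hi                   ∎
  where open ≤-Reasoning

decreasing-length : ∀ xs lo hi → lo ≤ hi → AllPairs (λ x y → y < x) xs → All (lo ≤_) xs → All (_< hi) xs →
                    length xs + lo ≤ hi
decreasing-length [] lo hi lo≤hi _ _ _ = lo≤hi
decreasing-length (x ∷ xs) lo hi lo≤hi (xs<x ∷ sorted) (lo≤x ∷ lo≤xs) (x<hi ∷ _) =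
  ≤-trans (s≤s (decreasing-length xs lo x lo≤x sorted lo≤xs xs<x)) x<hi

increasing⇒range : ∀ c lo xs → AllPairs _<_ xs → All (lo ≤_) xs → All (_< lo + c) xs → length xs ≡ c →
                   xs ≡ range lo c
increasing⇒range zero lo [] _ _ _ _ = refl
increasing⇒range (suc c) lo (x ∷ xs) (x<xs ∷ sorted) (lo≤x ∷ _) (x<top ∷ xs<top) e =
  cong₂ _∷_ x≡lo (increasing⇒range c (suc lo) xs sorted (All.map (subst (_< _) x≡lo) x<xs)
                                    (All.map (λ {y} → subst (y <_) (+-suc lo c)) xs<top) (suc-injective e))
  where
  -- the head is the least of length-many increasing numbers below lo + c+1, so it is lo
  room : length (x ∷ xs) + x ≤ lo + suc c
  room = increasing-length (x ∷ xs) x (lo + suc c) (<⇒≤ x<top) (x<xs ∷ sorted) (≤-refl ∷ All.map <⇒≤ x<xs) (x<top ∷ xs<top)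
  x≡lo : x ≡ lo
  x≡lo = ≤-antisym (+-cancelˡ-≤ (suc c) x lo (subst₂ _≤_ (cong (_+ x) e) (+-comm lo (suc c)) room)) lo≤x

decreasing⇒revRange : ∀ c lo xs → AllPairs (λ x y → y < x) xs → All (lo ≤_) xs → All (_< lo + c) xs →
                      length xs ≡ c → xs ≡ revRange lo c
decreasing⇒revRange zero lo [] _ _ _ _ = refl
decreasing⇒revRange (suc c) lo (x ∷ xs) (xs<x ∷ sorted) (lo≤x ∷ lo≤xs) (x<top ∷ _) e =
  cong₂ _∷_ x≡top (decreasing⇒revRange c lo xs sorted lo≤xs (All.map (subst (_ <_) x≡top) xs<x) (suc-injective e))
  where
  -- the head is the largest of length-many decreasing numbers ≥ lo, so it is lo + c
  room : length (x ∷ xs) + lo ≤ suc x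
  room = decreasing-length (x ∷ xs) lo (suc x) (m≤n⇒m≤1+n lo≤x) (xs<x ∷ sorted) (lo≤x ∷ lo≤xs)
                           (≤-refl ∷ All.map m<n⇒m<1+n xs<x)
  x≡top : x ≡ lo + c
  x≡top = ≤-antisym (≤-pred (subst (x <_) (+-suc lo c) x<top))
                    (subst (_≤ x) (+-comm c lo) (≤-pred (subst (λ u → u + lo ≤ suc x) e room)))

length-range : ∀ a b → length (range a b) ≡ b
length-range a zero = refl
length-range a (suc b) = cong suc (length-range (suc a) b)

length-revRange : ∀ a b → length (revRange a b) ≡ b
length-revRange a zero = refl
length-revRange a (suc b) = cong suc (length-revRange a b)

range-bounds : ∀ a b → All (λ i → a ≤ i × i < a + b) (range a b)
range-bounds a zero = []
range-bounds a (suc b) =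
  (≤-refl , subst (a <_) (sym (+-suc a b)) (s≤s (m≤m+n a b)))
  ∷ All.map (λ { {i} (le , lt) → ≤-trans (n≤1+n a) le , subst (i <_) (sym (+-suc a b)) lt }) (range-bounds (suc a) b)

revRange-bounds : ∀ a b → All (λ i → a ≤ i × i < a + b) (revRange a b)
revRange-bounds a zero = []
revRange-bounds a (suc b) =
  (m≤m+n a b , subst (a + b <_) (sym (+-suc a b)) ≤-refl)
  ∷ All.map (λ { (le , lt) → le , ≤-trans lt (subst (a + b ≤_) (sym (+-suc a b)) (n≤1+n _)) }) (revRange-bounds a b)

range-snoc : ∀ a b → range a (suc b) ≡ range a b ++ (a + b) ∷ []
range-snoc a zero = cong (_∷ []) (sym (+-identityʳ a))
range-snoc a (suc b) =
  cong (a ∷_) (trans (range-snoc (suc a) b) (cong (λ x → range (suc a) b ++ x ∷ []) (sym (+-suc a b))))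

revRange↭range : ∀ a b → revRange a b ↭ range a b
revRange↭range a zero = ↭-refl
revRange↭range a (suc b) =
  subst (a + b ∷ revRange a b ↭_) (sym (range-snoc a b))
        (↭-trans (↭-prep (a + b) (revRange↭range a b)) (∷↭∷ʳ (a + b) (range a b)))

range-++ : ∀ a b c → range a b ++ range (a + b) c ≡ range a (b + c)
range-++ a zero c = cong (λ x → range x c) (+-identityʳ a)
range-++ a (suc b) c =
  cong (a ∷_) (trans (cong (λ x → range (suc a) b ++ range x c) (+-suc a b)) (range-++ (suc a) b c))

block : ℕ → ℕ → ℕ → Kind → List ℕ
block k n s pair = range 1 k
block k n s one = revRange (suc k) (n ∸ k)
block k n s two = revRange (suc n) (s ∸ n)

blocks↭range : ∀ k n s → k ≤ n → n ≤ s → block k n s pair ++ (block k n s one ++ block k n s two) ↭ range 1 s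
blocks↭range k n s k≤n n≤s = begin
  range 1 k ++ (revRange (suc k) (n ∸ k) ++ revRange (suc n) (s ∸ n))
    ↭⟨ ++⁺ (↭-refl {x = range 1 k}) (++⁺ (revRange↭range (suc k) (n ∸ k)) (revRange↭range (suc n) (s ∸ n))) ⟩
  range 1 k ++ (range (suc k) (n ∸ k) ++ range (suc n) (s ∸ n))
    ≡⟨ sym (++-assoc (range 1 k) _ _) ⟩
  (range 1 k ++ range (1 + k) (n ∸ k)) ++ range (suc n) (s ∸ n)
    ≡⟨ cong (_++ range (suc n) (s ∸ n)) (trans (range-++ 1 k (n ∸ k)) (cong (range 1) (m+[n∸m]≡n k≤n))) ⟩
  range 1 n ++ range (1 + n) (s ∸ n)
    ≡⟨ trans (range-++ 1 n (s ∸ n)) (cong (range 1) (m+[n∸m]≡n n≤s)) ⟩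
  range 1 s ∎
  where open PermutationReasoning


-- The labels of a labelled path are determined by its area word and its reading word,
-- because the reading word lists every diagonal as a block of known length.
++-cancel : ∀ {A : Set} (a b c d : List A) → length a ≡ length b → a ++ c ≡ b ++ d → a ≡ b × c ≡ d
++-cancel [] [] c d _ e = refl , e
++-cancel (x ∷ a) (y ∷ b) c d le e with ∷-injective e
... | refl , e' = let (p , q) = ++-cancel a b c d (suc-injective le) e' in cong (x ∷_) p , q

concatMap-cancel : ∀ (f g : ℕ → List ℕ) ds → (∀ d → length (f d) ≡ length (g d)) →
                   concatMap f ds ≡ concatMap g ds → All (λ d → f d ≡ g d) ds
concatMap-cancel f g [] le e = []
concatMap-cancel f g (d ∷ ds) le e =
  let (p , q) = ++-cancel (f d) (g d) _ _ (le d) e in p ∷ concatMap-cancel f g ds le q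

length-labelsOnDiag : ∀ d as ls → length ls ≡ length as →
                      length (labelsOnDiag d (zip as ls)) ≡ countᵇ (_≡ᵇ d) as
length-labelsOnDiag d [] [] e = refl
length-labelsOnDiag d (a ∷ as) (l ∷ ls) e with a ≡ᵇ d
... | true = cong suc (length-labelsOnDiag d as ls (suc-injective e))
... | false = length-labelsOnDiag d as ls (suc-injective e)

labelsOnDiag-∷ : ∀ d a l xs → labelsOnDiag d ((a , l) ∷ xs) ≡
                 (if a ≡ᵇ d then l ∷ labelsOnDiag d xs else labelsOnDiag d xs)
labelsOnDiag-∷ d a l xs with a ≡ᵇ d
... | true = refl
... | false = refl

labels-by-diagonal : ∀ L as ls₁ ls₂ → length ls₁ ≡ length as → length ls₂ ≡ length as → All (_< L) as →
  (∀ d → d < L → labelsOnDiag d (zip as ls₁) ≡ labelsOnDiag d (zip as ls₂)) → ls₁ ≡ ls₂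
labels-by-diagonal L [] [] [] _ _ _ h = refl
labels-by-diagonal L (a ∷ as) (l₁ ∷ ls₁) (l₂ ∷ ls₂) e₁ e₂ (a<L ∷ as<L) h =
  cong₂ _∷_ (proj₁ (split a a<L) (≡⇒≡ᵇ a a refl))
            (labels-by-diagonal L as ls₁ ls₂ (suc-injective e₁) (suc-injective e₂) as<L (λ d lt → proj₂ (split d lt)))
  where
  t₁ t₂ : ℕ → List ℕ
  t₁ d = labelsOnDiag d (zip as ls₁)
  t₂ d = labelsOnDiag d (zip as ls₂)
  -- on diagonal d the heads agree if the first row lies on it, and the rest always agree
  split : ∀ d → d < L → (T (a ≡ᵇ d) → l₁ ≡ l₂) × t₁ d ≡ t₂ d
  split d lt with a ≡ᵇ d | trans (sym (labelsOnDiag-∷ d a l₁ _)) (trans (h d lt) (labelsOnDiag-∷ d a l₂ _))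
  ... | true | eq = (λ _ → ∷-injectiveˡ eq) , ∷-injectiveʳ eq
  ... | false | eq = (λ ()) , eq

readingWord-injective : ∀ L as ls₁ ls₂ → length ls₁ ≡ length as → length ls₂ ≡ length as → All (_< L) as →
  concatMap (λ d → labelsOnDiag d (zip as ls₁)) (upTo L) ≡ concatMap (λ d → labelsOnDiag d (zip as ls₂)) (upTo L) →
  ls₁ ≡ ls₂
readingWord-injective L as ls₁ ls₂ e₁ e₂ as<L e =
  labels-by-diagonal L as ls₁ ls₂ e₁ e₂ as<L (λ d → Allₚ.applyUpTo⁻ id L diagonals)
  where
  diagonals : All (λ d → labelsOnDiag d (zip as ls₁) ≡ labelsOnDiag d (zip as ls₂)) (upTo L)
  diagonals = concatMap-cancel _ _ (upTo L)
                (λ d → trans (length-labelsOnDiag d as ls₁ e₁) (sym (length-labelsOnDiag d as ls₂ e₂))) e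

filterᵇ-tails : ∀ {A : Set} (P : A → Bool) x y xs ys → P x ≡ P y →
                filterᵇ P (x ∷ xs) ≡ filterᵇ P (y ∷ ys) → filterᵇ P xs ≡ filterᵇ P ys
filterᵇ-tails P x y xs ys e h with P x | P y | e
... | true | true | _ = ∷-injectiveʳ h
... | false | false | _ = h

determined-by-kinds : ∀ {A : Set} (f : A → Kind) w₁ w₂ → map f w₁ ≡ map f w₂ →
                      (∀ κ → filterᵇ (λ l → sameKind (f l) κ) w₁ ≡ filterᵇ (λ l → sameKind (f l) κ) w₂) → w₁ ≡ w₂
determined-by-kinds f [] [] _ _ = refl
determined-by-kinds {A} f (x ∷ w₁) (y ∷ w₂) e h =
  cong₂ _∷_ x≡y (determined-by-kinds f w₁ w₂ (∷-injectiveʳ e)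
                   (λ κ → filterᵇ-tails _ x y w₁ w₂ (cong (λ c → sameKind c κ) fx≡fy) (h κ)))
  where
  fx≡fy : f x ≡ f y
  fx≡fy = ∷-injectiveˡ e
  -- both heads survive the filter for the kind of x
  x≡y : x ≡ y
  x≡y = ∷-injectiveˡ (begin
    x ∷ filterᵇ P w₁        ≡⟨ sym (filter-accept (T? ∘ P) {xs = w₁} (sameKind-refl (f x))) ⟩
    filterᵇ P (x ∷ w₁)      ≡⟨ h (f x) ⟩
    filterᵇ P (y ∷ w₂)      ≡⟨ filter-accept (T? ∘ P) {xs = w₂} (subst (λ c → T (sameKind c (f x))) fx≡fy
                                                                       (sameKind-refl (f x))) ⟩
    y ∷ filterᵇ P w₂        ∎)
    where
    open ≡-Reasoning
    P : A → Bool
    P l = sameKind (f l) (f x)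

⊆-filterᵇ : ∀ {A : Set} (P : A → Bool) {xs ys} → xs ⊆ ys → All (T ∘ P) xs → xs ⊆ filterᵇ P ys
⊆-filterᵇ P {xs} {ys} sub ok =
  subst (_⊆ filterᵇ P ys) (filter-all (T? ∘ P) ok) (Sublistₚ.filter⁺ (T? ∘ P) (T? ∘ P) (λ { refl p → p }) sub)

⊆-full : ∀ {A : Set} {xs ys : List A} → xs ⊆ ys → length ys ≤ length xs → xs ≡ ys
⊆-full sub le = ≋⇒≡ (Sublistₚ.to-≋ (≤-antisym (Sublistₚ.length-mono-≤ sub) le) sub)

LabelledRow : Set
LabelledRow = Row × ℕ

heightOf : LabelledRow → ℕ
heightOf ((a , κ) , l) = a

kindOf : LabelledRow → Kind
kindOf ((a , κ) , l) = κ

labelOf : LabelledRow → ℕ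
labelOf ((a , κ) , l) = l

ReadingOrdered : LabelledRow → LabelledRow → Set
ReadingOrdered z z' = kindOf z ≡ kindOf z' → KindOrder (kindOf z) (labelOf z) (labelOf z')

stdPair⇒readingOrdered : ∀ {z z'} → StdPair z z' →
  (heightOf z ≤ heightOf z' → ReadingOrdered z z') × (heightOf z' < heightOf z → ReadingOrdered z' z)
stdPair⇒readingOrdered {(a , κ) , l} {(a' , κ') , l'} sp =
  (λ le e → proj₁ (sp e) le) , (λ lt e → subst (λ c → KindOrder c l' l) (sym e) (proj₂ (sp (sym e)) lt))

map-proj₁-zip : ∀ {A B : Set} (xs : List A) (ls : List B) → length ls ≡ length xs → map proj₁ (zip xs ls) ≡ xs
map-proj₁-zip [] [] e = refl
map-proj₁-zip (x ∷ xs) (l ∷ ls) e = cong (x ∷_) (map-proj₁-zip xs ls (suc-injective e))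

map-proj₂-zip : ∀ {A B : Set} (xs : List A) (ls : List B) → length ls ≡ length xs → map proj₂ (zip xs ls) ≡ ls
map-proj₂-zip [] [] e = refl
map-proj₂-zip (x ∷ xs) (l ∷ ls) e = cong (l ∷_) (map-proj₂-zip xs ls (suc-injective e))

zip-map₁ : ∀ {A B C : Set} (f : A → C) (xs : List A) (ls : List B) →
           zip (map f xs) ls ≡ map (λ z → (f (proj₁ z) , proj₂ z)) (zip xs ls)
zip-map₁ f [] ls = refl
zip-map₁ f (x ∷ xs) [] = refl
zip-map₁ f (x ∷ xs) (l ∷ ls) = cong (_ ∷_) (zip-map₁ f xs ls)

kindTotal : ℕ → ℕ → ℕ → Kind → ℕ
kindTotal k n s pair = k
kindTotal k n s one = n ∸ k
kindTotal k n s two = s ∸ n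

length-block : ∀ k n s κ → length (block k n s κ) ≡ kindTotal k n s κ
length-block k n s pair = length-range 1 k
length-block k n s one = length-revRange (suc k) (n ∸ k)
length-block k n s two = length-revRange (suc n) (s ∸ n)

readingWord-rows : ∀ q (xs : List Row) ls → areaWord q ≡ map proj₁ xs →
                   readingWord q ls ≡ map labelOf (readingOrder heightOf (length ls) (zip xs ls))
readingWord-rows q xs ls area = trans
  (cong (λ u → concatMap (λ d → labelsOnDiag d u) (upTo (length ls))) (trans (cong (λ u → zip u ls) area) (zip-map₁ proj₁ xs ls)))
  (readingWord≡readingOrder heightOf labelOf (length ls) (zip xs ls))

-- Then, in reading order, the labels of each
-- kind are exactly the block of that kind; hence ls is a permutation of 1..s and every
-- block is a subsequence of the reading word.
module OrderedLabelling (k n s : ℕ) (k≤n : k ≤ n) (n≤s : n ≤ s) (xs : List Row) (ls : List ℕ)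
                        (len : length ls ≡ length xs) (ordered : AllPairs StdPair (zip xs ls))
                        (inBlock : All (RowInBlock k n s) (zip xs ls)) (tots : KindTotals k n s xs)
                        (L : ℕ) (below : All (λ x → proj₁ x < L) xs) where
  open KindTotals tots

  zs : List LabelledRow
  zs = zip xs ls

  RW : List LabelledRow
  RW = readingOrder heightOf L zs

  RW↭zs : RW ↭ zs
  RW↭zs = readingOrder-↭ heightOf L zs (All-zip xs ls below id)

  RW-ordered : AllPairs ReadingOrdered RW
  RW-ordered = readingOrder-AllPairs heightOf stdPair⇒readingOrdered L zs ordered

  RW-inBlock : All (RowInBlock k n s) RW
  RW-inBlock = All-resp-↭ (↭-sym RW↭zs) inBlock

  count-kind : ∀ κ → countᵇ (ofKind κ) xs ≡ kindTotal k n s κ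
  count-kind pair = #pair≡
  count-kind one = trans (sym (m+n∸n≡m _ k)) (cong (_∸ k) #one+k≡)
  count-kind two = trans (sym (m+n∸n≡m _ n)) (cong (_∸ n) #two+n≡)

  run : Kind → List LabelledRow
  run κ = filterᵇ (ofKind κ ∘ proj₁) RW

  length-run : ∀ κ → length (map labelOf (run κ)) ≡ kindTotal k n s κ
  length-run κ = begin
    length (map labelOf (run κ))         ≡⟨ length-map labelOf (run κ) ⟩
    countᵇ (ofKind κ ∘ proj₁) RW          ≡⟨ countᵇ-↭ _ RW↭zs ⟩
    countᵇ (ofKind κ ∘ proj₁) zs          ≡⟨ sym (countᵇ-map (ofKind κ) proj₁ zs) ⟩
    countᵇ (ofKind κ) (map proj₁ zs)      ≡⟨ cong (countᵇ (ofKind κ)) (map-proj₁-zip xs ls len) ⟩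
    countᵇ (ofKind κ) xs                  ≡⟨ count-kind κ ⟩
    kindTotal k n s κ                     ∎
    where open ≡-Reasoning

  run-kind : ∀ κ → All (λ z → kindOf z ≡ κ) (run κ)
  run-kind κ = All.map (λ {z} → sameKind-sound (kindOf z) κ) (Allₚ.all-filter (T? ∘ ofKind κ ∘ proj₁) RW)

  run-inBlock : ∀ κ → All (InBlock k n s κ ∘ labelOf) (run κ)
  run-inBlock κ = All.zipWith (λ {z} → retype {z}) (run-kind κ , Allₚ.filter⁺ (T? ∘ ofKind κ ∘ proj₁) RW-inBlock)
    where
    retype : ∀ {z} → kindOf z ≡ κ × RowInBlock k n s z → InBlock k n s κ (labelOf z)
    retype {z} (e , r) = subst (λ c → InBlock k n s c (labelOf z)) e r

  run-ordered : ∀ κ → AllPairs (KindOrder κ) (map labelOf (run κ))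
  run-ordered κ = AllPairsₚ.map⁺ (AllPairs-with (λ {z} {z'} → retype {z} {z'}) (run-kind κ)
                                                (AllPairsₚ.filter⁺ (T? ∘ ofKind κ ∘ proj₁) RW-ordered))
    where
    retype : ∀ {z z'} → kindOf z ≡ κ → kindOf z' ≡ κ → ReadingOrdered z z' → KindOrder κ (labelOf z) (labelOf z')
    retype {z} {z'} e e' r = subst (λ c → KindOrder c (labelOf z) (labelOf z')) e (r (trans e (sym e')))

  run-labels : ∀ κ → map labelOf (run κ) ≡ block k n s κ
  run-labels pair = increasing⇒range k 1 (map labelOf (run pair)) (run-ordered pair)
    (Allₚ.map⁺ (All.map proj₁ (run-inBlock pair)))
    (Allₚ.map⁺ (All.map (s≤s ∘ proj₂) (run-inBlock pair)))
    (length-run pair)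
  run-labels one = decreasing⇒revRange (n ∸ k) (suc k) (map labelOf (run one)) (run-ordered one)
    (Allₚ.map⁺ (All.map proj₁ (run-inBlock one)))
    (Allₚ.map⁺ (All.map (λ r → s≤s (subst (_ ≤_) (sym (m+[n∸m]≡n k≤n)) (proj₂ r))) (run-inBlock one)))
    (length-run one)
  run-labels two = decreasing⇒revRange (s ∸ n) (suc n) (map labelOf (run two)) (run-ordered two)
    (Allₚ.map⁺ (All.map proj₁ (run-inBlock two)))
    (Allₚ.map⁺ (All.map (λ r → s≤s (subst (_ ≤_) (sym (m+[n∸m]≡n n≤s)) (proj₂ r))) (run-inBlock two)))
    (length-run two)

  runs↭RW : run pair ++ (run one ++ run two) ↭ RW
  runs↭RW = begin
    run pair ++ (run one ++ run two)   ↭⟨ ++⁺ˡ (run pair) (filter-disjoint-↭ _ _ oneOrTwo (λ _ → refl) one≠two RW) ⟩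
    run pair ++ filterᵇ oneOrTwo RW    ↭⟨ filter-disjoint-↭ _ _ anyKind (λ _ → refl) pair≠oneOrTwo RW ⟩
    filterᵇ anyKind RW                 ≡⟨ filter-all (T? ∘ anyKind) (All.universal anyKind-T RW) ⟩
    RW                                 ∎
    where
    open PermutationReasoning
    oneOrTwo anyKind : LabelledRow → Bool
    oneOrTwo z = ofKind one (proj₁ z) ∨ ofKind two (proj₁ z)
    anyKind z = ofKind pair (proj₁ z) ∨ oneOrTwo z
    anyKind-T : ∀ z → T (anyKind z)
    anyKind-T ((a , pair) , l) = tt
    anyKind-T ((a , one) , l) = tt
    anyKind-T ((a , two) , l) = tt
    one≠two : ∀ z → T (ofKind one (proj₁ z)) → ¬ T (ofKind two (proj₁ z))
    one≠two ((a , one) , l) _ ()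
    one≠two ((a , pair) , l) ()
    one≠two ((a , two) , l) ()
    pair≠oneOrTwo : ∀ z → T (ofKind pair (proj₁ z)) → ¬ T (oneOrTwo z)
    pair≠oneOrTwo ((a , pair) , l) _ ()
    pair≠oneOrTwo ((a , one) , l) ()
    pair≠oneOrTwo ((a , two) , l) ()

  labels↭range : ls ↭ range 1 s
  labels↭range = begin
    ls                                          ≡⟨ sym (map-proj₂-zip xs ls len) ⟩
    map labelOf zs                              ↭⟨ ↭ₚ.map⁺ labelOf (↭-sym RW↭zs) ⟩
    map labelOf RW                              ↭⟨ ↭ₚ.map⁺ labelOf (↭-sym runs↭RW) ⟩
    map labelOf (run pair ++ (run one ++ run two))
      ≡⟨ trans (map-++ labelOf (run pair) _)
               (cong₂ _++_ (run-labels pair) (trans (map-++ labelOf (run one) _) (cong₂ _++_ (run-labels one) (run-labels two)))) ⟩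
    block k n s pair ++ (block k n s one ++ block k n s two)   ↭⟨ blocks↭range k n s k≤n n≤s ⟩
    range 1 s                                   ∎
    where open PermutationReasoning

  readingWord≡RW : ∀ q → areaWord q ≡ map proj₁ xs → L ≡ length ls → readingWord q ls ≡ map labelOf RW
  readingWord≡RW q area refl = readingWord-rows q xs ls area

  block⊆readingWord : ∀ q → areaWord q ≡ map proj₁ xs → L ≡ length ls → ∀ κ → block k n s κ ⊆ readingWord q ls
  block⊆readingWord q area eL κ =
    subst₂ _⊆_ (run-labels κ) (sym (readingWord≡RW q area eL))
               (Sublistₚ.map⁺ labelOf (Sublistₚ.filter-⊆ (T? ∘ ofKind κ ∘ proj₁) RW))

module Stacking (k n s : ℕ) (k≤n : k ≤ n) where

  -- For vertically adjacent rows (heights h and h+1) the lower label is the smaller one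
  -- exactly when the two kinds may be stacked.
  stacked-labels : ∀ {h κ κ' l l'} → (κ ≡ κ' → LabelOrder κ h (suc h) l l') →
                   InBlock k n s κ l → InBlock k n s κ' l' → (l < l' → CanStack κ κ') × (CanStack κ κ' → l < l')
  stacked-labels {h} {pair} {pair} sp _ _ = (λ _ → tt) , (λ _ → proj₁ (sp refl) (n≤1+n h))
  stacked-labels {κ = pair} {one} _ (_ , l≤k) (k<l' , _) = (λ _ → tt) , (λ _ → ≤-<-trans l≤k k<l')
  stacked-labels {κ = pair} {two} _ (_ , l≤k) (n<l' , _) = (λ _ → tt) , (λ _ → ≤-<-trans (≤-trans l≤k k≤n) n<l')
  stacked-labels {κ = one} {two} _ (_ , l≤n) (n<l' , _) = (λ _ → tt) , (λ _ → ≤-<-trans l≤n n<l')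
  stacked-labels {κ = one} {pair} _ (k<l , _) (_ , l'≤k) = (λ l<l' → <-irrefl refl (<-trans l<l' (≤-<-trans l'≤k k<l))) , λ ()
  stacked-labels {h} {one} {one} sp _ _ = (λ l<l' → <-asym l<l' (proj₁ (sp refl) (n≤1+n h))) , λ ()
  stacked-labels {κ = two} {pair} _ (n<l , _) (_ , l'≤k) =
    (λ l<l' → <-irrefl refl (<-trans l<l' (≤-<-trans (≤-trans l'≤k k≤n) n<l))) , λ ()
  stacked-labels {κ = two} {one} _ (n<l , _) (_ , l'≤n) = (λ l<l' → <-irrefl refl (<-trans l<l' (≤-<-trans l'≤n n<l))) , λ ()
  stacked-labels {h} {two} {two} sp _ _ = (λ l<l' → <-asym l<l' (proj₁ (sp refl) (n≤1+n h))) , λ ()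

  ordered⇒localCol : ∀ h bs ls → LocalKinds bs → AllPairs StdPair (zip (rows h bs) ls) →
                     All (RowInBlock k n s) (zip (rows h bs) ls) → LocalCol (shPath bs) ls
  ordered⇒localColAfter : ∀ h κ l bs ls → StackOK κ bs → All (StdPair ((h , κ) , l)) (zip (rows (suc h) bs) ls) →
                          InBlock k n s κ l → LocalKinds bs → AllPairs StdPair (zip (rows (suc h) bs) ls) →
                          All (RowInBlock k n s) (zip (rows (suc h) bs) ls) → LocalColAfter l (shPath bs) ls
  ordered⇒localCol h [] ls lk sp ib = tt
  ordered⇒localCol h (east ∷ bs) ls lk sp ib = ordered⇒localCol (pred h) bs ls lk sp ib
  ordered⇒localCol h (north κ ∷ bs) [] lk sp ib = tt
  ordered⇒localCol h (north κ ∷ bs) (l ∷ ls) (ok , lk) (sp₁ ∷ sp) (ib₁ ∷ ib) =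
    ordered⇒localColAfter h κ l bs ls ok sp₁ ib₁ lk sp ib
  ordered⇒localColAfter h κ l [] ls ok sp₁ ib₁ lk sp ib = tt
  ordered⇒localColAfter h κ l (east ∷ bs) ls ok sp₁ ib₁ lk sp ib = ordered⇒localCol h bs ls lk sp ib
  ordered⇒localColAfter h κ l (north κ' ∷ bs) [] ok sp₁ ib₁ lk sp ib = tt
  ordered⇒localColAfter h κ l (north κ' ∷ bs) (l' ∷ ls) ok (spₗ ∷ sp₁) ib₁ (ok' , lk) (sp₂ ∷ sp) (ib₂ ∷ ib) =
    proj₂ (stacked-labels spₗ ib₁ ib₂) ok , ordered⇒localColAfter (suc h) κ' l' bs ls ok' sp₂ ib₂ lk sp ib

  ordered⇒localKinds : ∀ h bs ls → length ls ≡ numN (shPath bs) → LocalCol (shPath bs) ls →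
                       AllPairs StdPair (zip (rows h bs) ls) → All (RowInBlock k n s) (zip (rows h bs) ls) → LocalKinds bs
  ordered⇒localKinds h [] ls e c sp ib = tt
  ordered⇒localKinds h (east ∷ bs) ls e c sp ib = ordered⇒localKinds (pred h) bs ls e c sp ib
  ordered⇒localKinds h (north κ ∷ bs) [] () c sp ib
  ordered⇒localKinds h (north κ ∷ []) (l ∷ ls) e c sp ib = tt , tt
  ordered⇒localKinds h (north κ ∷ east ∷ bs) (l ∷ ls) e c (_ ∷ sp) (_ ∷ ib) =
    tt , ordered⇒localKinds (suc h) (east ∷ bs) ls (suc-injective e) c sp ib
  ordered⇒localKinds h (north κ ∷ north κ' ∷ bs) (l ∷ []) () c sp ib
  ordered⇒localKinds h (north κ ∷ north κ' ∷ bs) (l ∷ l' ∷ ls) e (l<l' , c) ((spₗ ∷ _) ∷ sp) (ib₁ ∷ ib@(ib₂ ∷ _)) =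
    proj₁ (stacked-labels spₗ ib₁ ib₂) l<l' , ordered⇒localKinds (suc h) (north κ' ∷ bs) (l' ∷ ls) (suc-injective e) c sp ib

filterᵇ-map : ∀ {A B : Set} (f : A → B) (P : B → Bool) xs → filterᵇ P (map f xs) ≡ map f (filterᵇ (P ∘ f) xs)
filterᵇ-map f P [] = refl
filterᵇ-map f P (x ∷ xs) with P (f x)
... | true = cong (f x ∷_) (filterᵇ-map f P xs)
... | false = filterᵇ-map f P xs

filterᵇ-local : ∀ {A : Set} (P Q : A → Bool) xs → All (λ x → P x ≡ Q x) xs → filterᵇ P xs ≡ filterᵇ Q xs
filterᵇ-local P Q [] _ = refl
filterᵇ-local P Q (x ∷ xs) (e ∷ es) with P x | Q x | e
... | true | true | _ = cong (x ∷_) (filterᵇ-local P Q xs es)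
... | false | false | _ = filterᵇ-local P Q xs es

countᵇ-const : ∀ {A : Set} (b : Bool) (xs : List A) → countᵇ (λ _ → b) xs ≡ (if b then length xs else 0)
countᵇ-const true [] = refl
countᵇ-const false [] = refl
countᵇ-const true (x ∷ xs) = cong suc (countᵇ-const true xs)
countᵇ-const false (x ∷ xs) = countᵇ-const false xs

readingOrder-rows : ∀ L (xs : List Row) (ls : List ℕ) → length ls ≡ length xs →
                    map proj₁ (readingOrder heightOf L (zip xs ls)) ≡ readingOrder proj₁ L xs
readingOrder-rows L xs ls e = trans (map-concatMap proj₁ (onDiagonal heightOf (zip xs ls)) (upTo L))
  (concatMap-cong (λ d → trans (sym (filterᵇ-map proj₁ (λ x → proj₁ x ≡ᵇ d) (zip xs ls)))
                               (cong (λ u → onDiagonal proj₁ u d) (map-proj₁-zip xs ls e))) (upTo L))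

module Recovery (k n s : ℕ) (k≤n : k ≤ n) (n≤s : n ≤ s) where

  labelKind : ℕ → Kind
  labelKind l = if l ≤ᵇ k then pair else (if l ≤ᵇ n then one else two)

  labelKind-inBlock : ∀ κ l → InBlock k n s κ l → labelKind l ≡ κ
  labelKind-inBlock pair l (_ , l≤k) with l ≤ᵇ k | ≤⇒≤ᵇ l≤k
  ... | true | _ = refl
  labelKind-inBlock one l (k<l , l≤n) with l ≤ᵇ k in e | l ≤ᵇ n | ≤⇒≤ᵇ l≤n
  ... | false | true | _ = refl
  ... | true | _ | _ = ⊥-elim (<⇒≱ k<l (≤ᵇ⇒≤ l k (subst T (sym e) tt)))
  labelKind-inBlock two l (n<l , _) with l ≤ᵇ k in e₁ | l ≤ᵇ n in e₂
  ... | false | false = refl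
  ... | true | _ = ⊥-elim (<⇒≱ (≤-<-trans k≤n n<l) (≤ᵇ⇒≤ l k (subst T (sym e₁) tt)))
  ... | false | true = ⊥-elim (<⇒≱ n<l (≤ᵇ⇒≤ l n (subst T (sym e₂) tt)))

  block-inBlock : ∀ κ → All (InBlock k n s κ) (block k n s κ)
  block-inBlock pair = All.map (λ { (1≤i , i<1+k) → 1≤i , ≤-pred i<1+k }) (range-bounds 1 k)
  block-inBlock one = All.map (λ { {i} (k<i , i<top) → k<i , ≤-pred (subst (i <_) (cong suc (m+[n∸m]≡n k≤n)) i<top) })
                              (revRange-bounds (suc k) (n ∸ k))
  block-inBlock two = All.map (λ { {i} (n<i , i<top) → n<i , ≤-pred (subst (i <_) (cong suc (m+[n∸m]≡n n≤s)) i<top) })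
                              (revRange-bounds (suc n) (s ∸ n))

  labelKinds : ∀ (xs : List Row) ls → length ls ≡ length xs → All (RowInBlock k n s) (zip xs ls) →
               map labelKind ls ≡ map proj₂ xs
  labelKinds [] [] _ _ = refl
  labelKinds ((a , κ) ∷ xs) (l ∷ ls) e (ib ∷ ibs) =
    cong₂ _∷_ (labelKind-inBlock κ l ib) (labelKinds xs ls (suc-injective e) ibs)

  ofLabelKind : Kind → ℕ → Bool
  ofLabelKind κ l = sameKind (labelKind l) κ

  countᵇ-block : ∀ κ κ' → countᵇ (ofLabelKind κ) (block k n s κ') ≡ (if sameKind κ' κ then kindTotal k n s κ' else 0)
  countᵇ-block κ κ' = begin
    countᵇ (ofLabelKind κ) (block k n s κ')
      ≡⟨ countᵇ-local _ _ (block k n s κ')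
           (All.map (λ {l} ib → cong (λ c → sameKind c κ) (labelKind-inBlock κ' l ib)) (block-inBlock κ')) ⟩
    countᵇ (λ _ → sameKind κ' κ) (block k n s κ')
      ≡⟨ countᵇ-const (sameKind κ' κ) (block k n s κ') ⟩
    (if sameKind κ' κ then length (block k n s κ') else 0)
      ≡⟨ cong (λ u → if sameKind κ' κ then u else 0) (length-block k n s κ') ⟩
    (if sameKind κ' κ then kindTotal k n s κ' else 0) ∎
    where open ≡-Reasoning

  count-range : ∀ κ → countᵇ (ofLabelKind κ) (range 1 s) ≡ kindTotal k n s κ
  count-range κ = begin
    countᵇ P (range 1 s)
      ≡⟨ countᵇ-↭ P (↭-sym (blocks↭range k n s k≤n n≤s)) ⟩
    countᵇ P (block k n s pair ++ (block k n s one ++ block k n s two))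
      ≡⟨ trans (countᵇ-++ P (block k n s pair) _) (cong (countᵇ P (block k n s pair) +_) (countᵇ-++ P (block k n s one) _)) ⟩
    countᵇ P (block k n s pair) + (countᵇ P (block k n s one) + countᵇ P (block k n s two))
      ≡⟨ cong₂ _+_ (countᵇ-block κ pair) (cong₂ _+_ (countᵇ-block κ one) (countᵇ-block κ two)) ⟩
    _ ≡⟨ select κ ⟩
    kindTotal k n s κ ∎
    where
    open ≡-Reasoning
    P : ℕ → Bool
    P = ofLabelKind κ
    select : ∀ κ → (if sameKind pair κ then k else 0) +
                   ((if sameKind one κ then n ∸ k else 0) + (if sameKind two κ then s ∸ n else 0)) ≡ kindTotal k n s κ
    select pair = +-identityʳ k
    select one = +-identityʳ (n ∸ k)
    select two = refl

  module Recover (q : List Step) (ms : List ℕ) (walk : Walk 0 q) (#ms : length ms ≡ numN q)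
                 (perm : ms ↭ range 1 s) (blocks⊆ : ∀ κ → block k n s κ ⊆ readingWord q ms) where

    bs : List Token
    bs = tokenize q (map labelKind ms)

    tokens : shPath bs ≡ q × kinds bs ≡ map labelKind ms
    tokens = shPath-tokenize q (map labelKind ms) (trans (length-map labelKind ms) #ms)

    xs : List Row
    xs = rows 0 bs

    heights-xs : map proj₁ xs ≡ areaWord q
    heights-xs = trans (sym (heights-shPath 0 bs)) (trans (cong (heights 0) (proj₁ tokens)) (sym (areaWord≡heights q walk)))

    kinds-xs : map proj₂ xs ≡ map labelKind ms
    kinds-xs = trans (kinds-rows 0 bs) (proj₂ tokens)

    length-xs : length ms ≡ length xs
    length-xs = trans (sym (length-map labelKind ms)) (trans (cong length (sym kinds-xs)) (length-map proj₂ xs))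

    count-xs : ∀ κ → countᵇ (ofKind κ) xs ≡ kindTotal k n s κ
    count-xs κ = begin
      countᵇ (ofKind κ) xs                                  ≡⟨ sym (countᵇ-map (λ κ' → sameKind κ' κ) proj₂ xs) ⟩
      countᵇ (λ κ' → sameKind κ' κ) (map proj₂ xs)          ≡⟨ cong (countᵇ (λ κ' → sameKind κ' κ)) kinds-xs ⟩
      countᵇ (λ κ' → sameKind κ' κ) (map labelKind ms)      ≡⟨ countᵇ-map (λ κ' → sameKind κ' κ) labelKind ms ⟩
      countᵇ (ofLabelKind κ) ms                             ≡⟨ countᵇ-↭ _ perm ⟩
      countᵇ (ofLabelKind κ) (range 1 s)                    ≡⟨ count-range κ ⟩
      kindTotal k n s κ                                     ∎
      where open ≡-Reasoning

    tots : KindTotals k n s xs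
    tots = record { #pair≡ = count-xs pair
                  ; #one+k≡ = trans (cong (_+ k) (count-xs one)) (m∸n+n≡m k≤n)
                  ; #two+n≡ = trans (cong (_+ n) (count-xs two)) (m∸n+n≡m n≤s) }

    open Standardisation k n s xs tots

    sl : List ℕ
    sl = standardise n s xs

    length-sl : length sl ≡ length xs
    length-sl = length-mapWithContext (standardLabel n s) [] xs

    L : ℕ
    L = length ms

    below : All (λ x → proj₁ x < L) xs
    below = Allₚ.map⁻ (subst (All (_< L)) (sym heights-xs)
              (subst (λ u → All (_< u) (areaWord q)) (sym #ms)
                (subst (All (_< numN q)) (sym (areaWord≡heights q walk)) (heights-bound 0 0 q walk z≤n))))

    module Std = OrderedLabelling k n s k≤n n≤s xs sl length-sl standardise-stdPair standardise-inBlock tots L below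

    RWₘ : List LabelledRow
    RWₘ = readingOrder heightOf L (zip xs ms)

    RWₘ↭ : RWₘ ↭ zip xs ms
    RWₘ↭ = readingOrder-↭ heightOf L (zip xs ms) (All-zip xs ms below id)

    kinds-sl : All (λ z → labelKind (labelOf z) ≡ kindOf z) Std.RW
    kinds-sl = All.map (λ { {(a , κ) , l} ib → labelKind-inBlock κ l ib }) Std.RW-inBlock

    kinds-ms : All (λ z → labelKind (labelOf z) ≡ kindOf z) RWₘ
    kinds-ms = All-resp-↭ (↭-sym RWₘ↭) (zip-kinds xs ms kinds-xs)
      where
      zip-kinds : ∀ (xs : List Row) ms → map proj₂ xs ≡ map labelKind ms →
                  All (λ z → labelKind (labelOf z) ≡ kindOf z) (zip xs ms)
      zip-kinds [] ms e = []
      zip-kinds (x ∷ xs) [] e = []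
      zip-kinds (x ∷ xs) (l ∷ ms) e = sym (∷-injectiveˡ e) ∷ zip-kinds xs ms (∷-injectiveʳ e)

    kind-sequence : ∀ RW → All (λ z → labelKind (labelOf z) ≡ kindOf z) RW → map proj₁ RW ≡ readingOrder proj₁ L xs →
                    map labelKind (map labelOf RW) ≡ map proj₂ (readingOrder proj₁ L xs)
    kind-sequence RW ok e =
      trans (sym (map-∘ RW)) (trans (map-cong-local ok) (trans (map-∘ RW) (cong (map proj₂) e)))

    run-sl : ∀ κ → filterᵇ (ofLabelKind κ) (map labelOf Std.RW) ≡ block k n s κ
    run-sl κ = begin
      filterᵇ (ofLabelKind κ) (map labelOf Std.RW)              ≡⟨ filterᵇ-map labelOf (ofLabelKind κ) Std.RW ⟩
      map labelOf (filterᵇ (ofLabelKind κ ∘ labelOf) Std.RW)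
        ≡⟨ cong (map labelOf) (filterᵇ-local _ _ Std.RW (All.map (cong (λ c → sameKind c κ)) kinds-sl)) ⟩
      map labelOf (Std.run κ)                                   ≡⟨ Std.run-labels κ ⟩
      block k n s κ                                             ∎
      where open ≡-Reasoning

    run-ms : ∀ κ → filterᵇ (ofLabelKind κ) (map labelOf RWₘ) ≡ block k n s κ
    run-ms κ = sym (⊆-full sub (≤-reflexive count))
      where
      sub : block k n s κ ⊆ filterᵇ (ofLabelKind κ) (map labelOf RWₘ)
      sub = ⊆-filterᵇ (ofLabelKind κ) (subst (block k n s κ ⊆_) (readingWord-rows q xs ms (sym heights-xs)) (blocks⊆ κ))
                      (All.map (λ {l} ib → subst (λ c → T (sameKind c κ)) (sym (labelKind-inBlock κ l ib)) (sameKind-refl κ))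
                               (block-inBlock κ))
      count : countᵇ (ofLabelKind κ) (map labelOf RWₘ) ≡ length (block k n s κ)
      count = begin
        countᵇ (ofLabelKind κ) (map labelOf RWₘ)       ≡⟨ countᵇ-↭ _ (↭ₚ.map⁺ labelOf RWₘ↭) ⟩
        countᵇ (ofLabelKind κ) (map labelOf (zip xs ms)) ≡⟨ cong (countᵇ _) (map-proj₂-zip xs ms length-xs) ⟩
        countᵇ (ofLabelKind κ) ms                      ≡⟨ countᵇ-↭ _ perm ⟩
        countᵇ (ofLabelKind κ) (range 1 s)             ≡⟨ count-range κ ⟩
        kindTotal k n s κ                              ≡⟨ sym (length-block k n s κ) ⟩
        length (block k n s κ)                         ∎
        where open ≡-Reasoning

    same-readingWord : readingWord q sl ≡ readingWord q ms
    same-readingWord = begin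
      readingWord q sl           ≡⟨ Std.readingWord≡RW q (sym heights-xs) (sym (trans length-sl (sym length-xs))) ⟩
      map labelOf Std.RW         ≡⟨ determined-by-kinds labelKind _ _ same-kinds (λ κ → trans (run-sl κ) (sym (run-ms κ))) ⟩
      map labelOf RWₘ            ≡⟨ sym (readingWord-rows q xs ms (sym heights-xs)) ⟩
      readingWord q ms           ∎
      where
      open ≡-Reasoning
      same-kinds : map labelKind (map labelOf Std.RW) ≡ map labelKind (map labelOf RWₘ)
      same-kinds = trans (kind-sequence Std.RW kinds-sl (readingOrder-rows L xs sl length-sl))
                         (sym (kind-sequence RWₘ kinds-ms (readingOrder-rows L xs ms length-xs)))

    recover : sl ≡ ms
    recover = readingWord-injective L (areaWord q) sl ms (trans length-sl length-rows′) (trans length-xs length-rows′)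
                (subst (All (_< L)) heights-xs (Allₚ.map⁺ below))
                (subst (λ u → concatMap (λ d → labelsOnDiag d (zip (areaWord q) sl)) (upTo u) ≡ readingWord q ms)
                       (trans length-sl (sym length-xs)) same-readingWord)
      where
      length-rows′ : length xs ≡ length (areaWord q)
      length-rows′ = trans (sym (length-map proj₁ xs)) (cong length heights-xs)

-- dinv: a sum over pairs of cells.  We compare the cells of the PF² path, grouped by
-- token row, with the rows of the collapsed path.
toℕ : Bool → ℕ
toℕ true = 1
toℕ false = 0

sumPairs : ∀ {A : Set} → (A → A → ℕ) → List A → ℕ
sumPairs c [] = 0
sumPairs c (x ∷ xs) = sum (map (c x) xs) + sumPairs c xs

sumCross : ∀ {A : Set} → (A → A → ℕ) → List A → List A → ℕ
sumCross c [] B = 0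
sumCross c (u ∷ A) B = sum (map (c u) B) + sumCross c A B

countᵇ≡sum : ∀ {A : Set} (p : A → Bool) xs → countᵇ p xs ≡ sum (map (toℕ ∘ p) xs)
countᵇ≡sum p [] = refl
countᵇ≡sum p (x ∷ xs) with p x
... | true = cong suc (countᵇ≡sum p xs)
... | false = countᵇ≡sum p xs

countPairs≡sumPairs : ∀ {A : Set} (r : A → A → Bool) xs → countPairs r xs ≡ sumPairs (λ x y → toℕ (r x y)) xs
countPairs≡sumPairs r [] = refl
countPairs≡sumPairs r (x ∷ xs) = cong₂ _+_ (countᵇ≡sum (r x) xs) (countPairs≡sumPairs r xs)

sum-map-++ : ∀ {A : Set} (f : A → ℕ) xs ys → sum (map f (xs ++ ys)) ≡ sum (map f xs) + sum (map f ys)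
sum-map-++ f xs ys = trans (cong sum (map-++ f xs ys)) (sum-++ (map f xs) _)

sumCross-++ʳ : ∀ {A : Set} (c : A → A → ℕ) A B C → sumCross c A (B ++ C) ≡ sumCross c A B + sumCross c A C
sumCross-++ʳ c [] B C = refl
sumCross-++ʳ c (u ∷ A) B C =
  trans (cong₂ _+_ (sum-map-++ (c u) B C) (sumCross-++ʳ c A B C)) (+-+-comm (sum (map (c u) B)) _ _ _)
  where
  +-+-comm : ∀ a b x y → (a + b) + (x + y) ≡ (a + x) + (b + y)
  +-+-comm a b x y = trans (+-assoc a b (x + y)) (trans (cong (a +_) (trans (sym (+-assoc b x y))
                       (trans (cong (_+ y) (+-comm b x)) (+-assoc x b y)))) (sym (+-assoc a x (b + y))))

sumPairs-++ : ∀ {A : Set} (c : A → A → ℕ) A B → sumPairs c (A ++ B) ≡ sumPairs c A + sumCross c A B + sumPairs c B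
sumPairs-++ c [] B = refl
sumPairs-++ c (x ∷ A) B = begin
  sum (map (c x) (A ++ B)) + sumPairs c (A ++ B)
    ≡⟨ cong₂ _+_ (sum-map-++ (c x) A B) (sumPairs-++ c A B) ⟩
  (p + q) + ((r + t) + u)
    ≡⟨ +-assoc-swap ⟩
  ((p + r) + (q + t)) + u ∎
  where
  open ≡-Reasoning
  p q r t u : ℕ
  p = sum (map (c x) A)
  q = sum (map (c x) B)
  r = sumPairs c A
  t = sumCross c A B
  u = sumPairs c B
  +-assoc-swap : (p + q) + ((r + t) + u) ≡ ((p + r) + (q + t)) + u
  +-assoc-swap = trans (sym (+-assoc (p + q) (r + t) u)) (cong (_+ u) (trans (+-assoc p q (r + t))
                   (trans (cong (p +_) (trans (sym (+-assoc q r t)) (trans (cong (_+ t) (+-comm q r)) (+-assoc r q t))))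
                          (sym (+-assoc p r (q + t))))))

sumPairs-map : ∀ {A B : Set} (c : B → B → ℕ) (g : A → B) zs → sumPairs c (map g zs) ≡ sumPairs (λ z z' → c (g z) (g z')) zs
sumPairs-map c g [] = refl
sumPairs-map c g (z ∷ zs) = cong₂ _+_ (cong sum (sym (map-∘ zs))) (sumPairs-map c g zs)

sumPairs-local : ∀ {A : Set} (F G : A → A → ℕ) zs → AllPairs (λ z z' → F z z' ≡ G z z') zs → sumPairs F zs ≡ sumPairs G zs
sumPairs-local F G [] _ = refl
sumPairs-local F G (z ∷ zs) (e ∷ es) = cong₂ _+_ (cong sum (map-cong-local e)) (sumPairs-local F G zs es)

rowCells : Row → List (ℕ × ℕ)
rowCells (a , pair) = (a , 1) ∷ (suc a , 2) ∷ []
rowCells (a , one) = (a , 1) ∷ []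
rowCells (a , two) = (a , 2) ∷ []

sumPairs-cells : ∀ (c : ℕ × ℕ → ℕ × ℕ → ℕ) → (∀ x → sumPairs c (rowCells x) ≡ 0) →
                 ∀ xs → sumPairs c (concatMap rowCells xs) ≡ sumPairs (λ x x' → sumCross c (rowCells x) (rowCells x')) xs
sumPairs-cells c inside [] = refl
sumPairs-cells c inside (x ∷ xs) =
  trans (sumPairs-++ c (rowCells x) (concatMap rowCells xs))
        (cong₂ _+_ (trans (cong (_+ sumCross c (rowCells x) (concatMap rowCells xs)) (inside x)) (across xs))
                   (sumPairs-cells c inside xs))
  where
  across : ∀ ys → sumCross c (rowCells x) (concatMap rowCells ys) ≡ sum (map (λ x' → sumCross c (rowCells x) (rowCells x')) ys)
  across [] = sumCross-[] (rowCells x)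
    where
    sumCross-[] : ∀ A → sumCross c A [] ≡ 0
    sumCross-[] [] = refl
    sumCross-[] (u ∷ A) = sumCross-[] A
  across (y ∷ ys) = trans (sumCross-++ʳ c (rowCells x) (rowCells y) (concatMap rowCells ys))
                          (cong (sumCross c (rowCells x) (rowCells y) +_) (across ys))

zip-pfHeights : ∀ h bs → zip (pfHeights (rows h bs)) (pfLabels bs) ≡ concatMap rowCells (rows h bs)
zip-pfHeights h [] = refl
zip-pfHeights h (east ∷ bs) = zip-pfHeights (pred h) bs
zip-pfHeights h (north pair ∷ bs) = cong (λ u → (h , 1) ∷ (suc h , 2) ∷ u) (zip-pfHeights (suc h) bs)
zip-pfHeights h (north one ∷ bs) = cong ((h , 1) ∷_) (zip-pfHeights (suc h) bs)
zip-pfHeights h (north two ∷ bs) = cong ((h , 2) ∷_) (zip-pfHeights (suc h) bs)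

dinv-11 : ∀ u v → dinvRel (u , 1) (v , 1) ≡ false
dinv-11 u v rewrite ∧-zeroʳ (u ≡ᵇ v) | ∧-zeroʳ (u ≡ᵇ suc v) = refl

dinv-22 : ∀ u v → dinvRel (u , 2) (v , 2) ≡ false
dinv-22 u v rewrite ∧-zeroʳ (u ≡ᵇ v) | ∧-zeroʳ (u ≡ᵇ suc v) = refl

dinv-12 : ∀ u v → dinvRel (u , 1) (v , 2) ≡ (u ≡ᵇ v)
dinv-12 u v rewrite ∧-identityʳ (u ≡ᵇ v) | ∧-zeroʳ (u ≡ᵇ suc v) = ∨-identityʳ (u ≡ᵇ v)

dinv-21 : ∀ u v → dinvRel (u , 2) (v , 1) ≡ (u ≡ᵇ suc v)
dinv-21 u v rewrite ∧-zeroʳ (u ≡ᵇ v) | ∧-identityʳ (u ≡ᵇ suc v) = refl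

cellDinv : ℕ × ℕ → ℕ × ℕ → ℕ
cellDinv u v = toℕ (dinvRel u v)

≡ᵇ-suc-false : ∀ a → (a ≡ᵇ suc a) ≡ false
≡ᵇ-suc-false zero = refl
≡ᵇ-suc-false (suc a) = ≡ᵇ-suc-false a

-- The two cells of a pair are on consecutive diagonals, 1 below 2: no inversion.
cellDinv-inside : ∀ x → sumPairs cellDinv (rowCells x) ≡ 0
cellDinv-inside (a , pair) rewrite dinv-12 a (suc a) | ≡ᵇ-suc-false a = refl
cellDinv-inside (a , one) = refl
cellDinv-inside (a , two) = refl

-- Diagonal inversions between the cells of two token rows at heights a, a' (the first
-- row before the second), as a function of e₀ = (a ≡ a') and e₁ = (a ≡ a'+1).
rowDinvTable : Kind → Kind → Bool → Bool → ℕ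
rowDinvTable pair pair e₀ e₁ = toℕ e₁ + toℕ e₀
rowDinvTable pair one e₀ e₁ = toℕ e₀
rowDinvTable pair two e₀ e₁ = toℕ e₀
rowDinvTable one pair e₀ e₁ = toℕ e₁
rowDinvTable one one e₀ e₁ = 0
rowDinvTable one two e₀ e₁ = toℕ e₀
rowDinvTable two pair e₀ e₁ = toℕ e₁
rowDinvTable two one e₀ e₁ = toℕ e₁
rowDinvTable two two e₀ e₁ = 0

rowDinv-table : ∀ a κ a' κ' → sumCross cellDinv (rowCells (a , κ)) (rowCells (a' , κ')) ≡
                              rowDinvTable κ κ' (a ≡ᵇ a') (a ≡ᵇ suc a')
rowDinv-table a pair a' pair rewrite dinv-11 a a' | dinv-12 a (suc a') | dinv-21 (suc a) a' with a ≡ᵇ a' | a ≡ᵇ suc a'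
... | true | true = refl
... | true | false = refl
... | false | true = refl
... | false | false = refl
rowDinv-table a pair a' one rewrite dinv-11 a a' | dinv-21 (suc a) a' with a ≡ᵇ a' | a ≡ᵇ suc a'
... | true | _ = refl
... | false | _ = refl
rowDinv-table a pair a' two rewrite dinv-12 a a' | dinv-22 (suc a) a' with a ≡ᵇ a' | a ≡ᵇ suc a'
... | true | _ = refl
... | false | _ = refl
rowDinv-table a one a' pair rewrite dinv-11 a a' | dinv-12 a (suc a') with a ≡ᵇ a' | a ≡ᵇ suc a'
... | _ | true = refl
... | _ | false = refl
rowDinv-table a one a' one rewrite dinv-11 a a' = refl
rowDinv-table a one a' two rewrite dinv-12 a a' with a ≡ᵇ a' | a ≡ᵇ suc a'
... | true | _ = refl
... | false | _ = refl
rowDinv-table a two a' pair rewrite dinv-21 a a' | dinv-22 a (suc a') with a ≡ᵇ a' | a ≡ᵇ suc a'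
... | _ | true = refl
... | _ | false = refl
rowDinv-table a two a' one rewrite dinv-21 a a' with a ≡ᵇ a' | a ≡ᵇ suc a'
... | _ | true = refl
... | _ | false = refl
rowDinv-table a two a' two rewrite dinv-22 a a' = refl

<ᵇ-true : ∀ {x y} → x < y → (x <ᵇ y) ≡ true
<ᵇ-true lt = Equivalence.to T-≡ (<⇒<ᵇ lt)

table⇒dinvRel : ∀ a a' l l' (t : Bool → Bool → ℕ) b₀ b₁ → t true false ≡ toℕ b₀ → t false true ≡ toℕ b₁ →
                t false false ≡ 0 → (a ≡ a' → (l <ᵇ l') ≡ b₀) → (a ≡ suc a' → (l' <ᵇ l) ≡ b₁) →
                t (a ≡ᵇ a') (a ≡ᵇ suc a') ≡ toℕ (dinvRel (a , l) (a' , l'))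
table⇒dinvRel a a' l l' t b₀ b₁ t₀ t₁ t₂ v₀ v₁ with a ≡ᵇ a' in e₀ | a ≡ᵇ suc a' in e₁
... | true | true = ⊥-elim (1+n≢n (trans (sym (≡ᵇ⇒≡ a (suc a') (subst T (sym e₁) tt))) (≡ᵇ⇒≡ a a' (subst T (sym e₀) tt))))
... | true | false rewrite v₀ (≡ᵇ⇒≡ a a' (subst T (sym e₀) tt)) | ∨-identityʳ b₀ = t₀
... | false | true rewrite v₁ (≡ᵇ⇒≡ a (suc a') (subst T (sym e₁) tt)) = t₁
... | false | false = t₂

module DinvPreservation (k n s : ℕ) (k≤n : k ≤ n) where

  standard-rowDinv : ∀ a κ l a' κ' l' → StdPair ((a , κ) , l) ((a' , κ') , l') → InBlock k n s κ l → InBlock k n s κ' l' →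
                     rowDinvTable κ κ' (a ≡ᵇ a') (a ≡ᵇ suc a') ≡ toℕ (dinvRel (a , l) (a' , l'))
  standard-rowDinv a pair l a' pair l' sp r r' =
    table⇒dinvRel a a' l l' (rowDinvTable pair pair) true true refl refl refl (λ e → <ᵇ-true (proj₁ (sp refl) (≤-reflexive e)))
                  (λ e → <ᵇ-true (proj₂ (sp refl) (subst (a' <_) (sym e) ≤-refl)))
  standard-rowDinv a pair l a' one l' sp (_ , l≤k) (k<l' , _) =
    table⇒dinvRel a a' l l' (rowDinvTable pair one) true false refl refl refl (λ _ → <ᵇ-true (≤-<-trans l≤k k<l'))
                  (λ _ → <ᵇ-false (<⇒≤ (≤-<-trans l≤k k<l')))
  standard-rowDinv a pair l a' two l' sp (_ , l≤k) (n<l' , _) =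
    table⇒dinvRel a a' l l' (rowDinvTable pair two) true false refl refl refl (λ _ → <ᵇ-true (≤-<-trans (≤-trans l≤k k≤n) n<l'))
                  (λ _ → <ᵇ-false (<⇒≤ (≤-<-trans (≤-trans l≤k k≤n) n<l')))
  standard-rowDinv a one l a' pair l' sp (k<l , _) (_ , l'≤k) =
    table⇒dinvRel a a' l l' (rowDinvTable one pair) false true refl refl refl (λ _ → <ᵇ-false (<⇒≤ (≤-<-trans l'≤k k<l)))
                  (λ _ → <ᵇ-true (≤-<-trans l'≤k k<l))
  standard-rowDinv a one l a' one l' sp r r' =
    table⇒dinvRel a a' l l' (rowDinvTable one one) false false refl refl refl (λ e → <ᵇ-false (<⇒≤ (proj₁ (sp refl) (≤-reflexive e))))
                  (λ e → <ᵇ-false (<⇒≤ (proj₂ (sp refl) (subst (a' <_) (sym e) ≤-refl))))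
  standard-rowDinv a one l a' two l' sp (_ , l≤n) (n<l' , _) =
    table⇒dinvRel a a' l l' (rowDinvTable one two) true false refl refl refl (λ _ → <ᵇ-true (≤-<-trans l≤n n<l'))
                  (λ _ → <ᵇ-false (<⇒≤ (≤-<-trans l≤n n<l')))
  standard-rowDinv a two l a' pair l' sp (n<l , _) (_ , l'≤k) =
    table⇒dinvRel a a' l l' (rowDinvTable two pair) false true refl refl refl (λ _ → <ᵇ-false (<⇒≤ (≤-<-trans (≤-trans l'≤k k≤n) n<l)))
                  (λ _ → <ᵇ-true (≤-<-trans (≤-trans l'≤k k≤n) n<l))
  standard-rowDinv a two l a' one l' sp (n<l , _) (_ , l'≤n) =
    table⇒dinvRel a a' l l' (rowDinvTable two one) false true refl refl refl (λ _ → <ᵇ-false (<⇒≤ (≤-<-trans l'≤n n<l)))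
                  (λ _ → <ᵇ-true (≤-<-trans l'≤n n<l))
  standard-rowDinv a two l a' two l' sp r r' =
    table⇒dinvRel a a' l l' (rowDinvTable two two) false false refl refl refl (λ e → <ᵇ-false (<⇒≤ (proj₁ (sp refl) (≤-reflexive e))))
                  (λ e → <ᵇ-false (<⇒≤ (proj₂ (sp refl) (subst (a' <_) (sym e) ≤-refl))))

  pair-dinv : ∀ {z z'} → RowInBlock k n s z → RowInBlock k n s z' → StdPair z z' →
              sumCross cellDinv (rowCells (proj₁ z)) (rowCells (proj₁ z')) ≡ cellDinv (heightOf z , labelOf z) (heightOf z' , labelOf z')
  pair-dinv {(a , κ) , l} {(a' , κ') , l'} r r' sp = trans (rowDinv-table a κ a' κ') (standard-rowDinv a κ l a' κ' l' sp r r')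

  dinv-preserved : ∀ bs ls → Walk 0 (pfPath bs) → length ls ≡ length (rows 0 bs) →
                   AllPairs StdPair (zip (rows 0 bs) ls) → All (RowInBlock k n s) (zip (rows 0 bs) ls) →
                   dinvOf (shPath bs) ls ≡ dinvOf (pfPath bs) (pfLabels bs)
  dinv-preserved bs ls w len sp ib = begin
    countPairs dinvRel (zip (areaWord (shPath bs)) ls)
      ≡⟨ cong (λ u → countPairs dinvRel (zip u ls)) (trans (areaWord≡heights (shPath bs) (walk-pf⇒sh 0 bs w)) (heights-shPath 0 bs)) ⟩
    countPairs dinvRel (zip (map proj₁ xs) ls)
      ≡⟨ cong (countPairs dinvRel) (zip-map₁ proj₁ xs ls) ⟩
    countPairs dinvRel (map cell zs)
      ≡⟨ countPairs≡sumPairs dinvRel (map cell zs) ⟩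
    sumPairs cellDinv (map cell zs)
      ≡⟨ sumPairs-map cellDinv cell zs ⟩
    sumPairs (λ z z' → cellDinv (cell z) (cell z')) zs
      ≡⟨ sym (sumPairs-local _ _ zs (AllPairs-with pair-dinv ib sp)) ⟩
    sumPairs (λ z z' → rowDinv (proj₁ z) (proj₁ z')) zs
      ≡⟨ sym (sumPairs-map rowDinv proj₁ zs) ⟩
    sumPairs rowDinv (map proj₁ zs)
      ≡⟨ cong (sumPairs rowDinv) (map-proj₁-zip xs ls len) ⟩
    sumPairs rowDinv xs
      ≡⟨ sym (sumPairs-cells cellDinv cellDinv-inside xs) ⟩
    sumPairs cellDinv (concatMap rowCells xs)
      ≡⟨ sym (countPairs≡sumPairs dinvRel (concatMap rowCells xs)) ⟩
    countPairs dinvRel (concatMap rowCells xs)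
      ≡⟨ cong (countPairs dinvRel) (sym (zip-pfHeights 0 bs)) ⟩
    countPairs dinvRel (zip (pfHeights xs) (pfLabels bs))
      ≡⟨ cong (λ u → countPairs dinvRel (zip u (pfLabels bs))) (sym (trans (areaWord≡heights (pfPath bs) w) (heights-pfPath 0 bs))) ⟩
    countPairs dinvRel (zip (areaWord (pfPath bs)) (pfLabels bs)) ∎
    where
    open ≡-Reasoning
    xs : List Row
    xs = rows 0 bs
    zs : List LabelledRow
    zs = zip xs ls
    cell : LabelledRow → ℕ × ℕ
    cell z = heightOf z , labelOf z
    rowDinv : Row → Row → ℕ
    rowDinv x x' = sumCross cellDinv (rowCells x) (rowCells x')

-- Area: the decorated upper row of a pair does not count, so the PF² area is the sum of
-- the heights of the token rows.  (F is the summand of areaOf, which Defs keeps local.)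
area-pf : ∀ (F : Bool × ℕ → ℕ) → (∀ a → F (true , a) ≡ 0) → (∀ a → F (false , a) ≡ a) →
          ∀ h bs → sum (map F (zip (pfDecor bs) (pfHeights (rows h bs)))) ≡ sum (map proj₁ (rows h bs))
area-pf F ft ff h [] = refl
area-pf F ft ff h (east ∷ bs) = area-pf F ft ff (pred h) bs
area-pf F ft ff h (north pair ∷ bs) = cong₂ _+_ (ff h) (trans (cong₂ _+_ (ft (suc h)) refl) (area-pf F ft ff (suc h) bs))
area-pf F ft ff h (north one ∷ bs) = cong₂ _+_ (ff h) (area-pf F ft ff (suc h) bs)
area-pf F ft ff h (north two ∷ bs) = cong₂ _+_ (ff h) (area-pf F ft ff (suc h) bs)

area-preserved : ∀ bs → Walk 0 (pfPath bs) → sum (areaWord (shPath bs)) ≡ areaOf (pfPath bs) (pfDecor bs)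
area-preserved bs w = begin
  sum (areaWord (shPath bs))        ≡⟨ cong sum (trans (areaWord≡heights (shPath bs) (walk-pf⇒sh 0 bs w)) (heights-shPath 0 bs)) ⟩
  sum (map proj₁ (rows 0 bs))       ≡⟨ sym (area-pf-at _ (λ _ → refl) (λ _ → refl) (areaWord (pfPath bs)) (trans (areaWord≡heights (pfPath bs) w) (heights-pfPath 0 bs))) ⟩
  areaOf (pfPath bs) (pfDecor bs)   ∎
  where
  open ≡-Reasoning
  area-pf-at : ∀ (F : Bool × ℕ → ℕ) → (∀ a → F (true , a) ≡ 0) → (∀ a → F (false , a) ≡ a) →
               ∀ u → u ≡ pfHeights (rows 0 bs) → sum (map F (zip (pfDecor bs) u)) ≡ sum (map proj₁ (rows 0 bs))
  area-pf-at F ft ff u refl = area-pf F ft ff 0 bs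

pfDecor-rises : ∀ a h bs → DecorsAreRises (pfDecor bs) (riseAux a (pfHeights (rows h bs)))
pfDecor-rises a h [] = []
pfDecor-rises a h (east ∷ bs) = pfDecor-rises a (pred h) bs
pfDecor-rises a h (north pair ∷ bs) = (λ ()) ∷ (λ _ → <ᵇ-true (n<1+n h)) ∷ pfDecor-rises (suc h) (suc h) bs
pfDecor-rises a h (north one ∷ bs) = (λ ()) ∷ pfDecor-rises h (suc h) bs
pfDecor-rises a h (north two ∷ bs) = (λ ()) ∷ pfDecor-rises h (suc h) bs

pfDecor-rises₀ : ∀ h bs → DecorsAreRises (pfDecor bs) (riseFlags (pfHeights (rows h bs)))
pfDecor-rises₀ h [] = []
pfDecor-rises₀ h (east ∷ bs) = pfDecor-rises₀ (pred h) bs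
pfDecor-rises₀ h (north pair ∷ bs) = (λ ()) ∷ (λ _ → <ᵇ-true (n<1+n h)) ∷ pfDecor-rises (suc h) (suc h) bs
pfDecor-rises₀ h (north one ∷ bs) = (λ ()) ∷ pfDecor-rises h (suc h) bs
pfDecor-rises₀ h (north two ∷ bs) = (λ ()) ∷ pfDecor-rises h (suc h) bs

size-shPath : ∀ bs → numN (shPath bs) ≡ #kind pair bs + #kind one bs + #kind two bs
size-shPath [] = refl
size-shPath (east ∷ bs) = size-shPath bs
size-shPath (north pair ∷ bs) = cong suc (size-shPath bs)
size-shPath (north one ∷ bs) =
  trans (cong suc (size-shPath bs)) (cong (_+ #kind two bs) (sym (+-suc (#kind pair bs) (#kind one bs))))
size-shPath (north two ∷ bs) = trans (cong suc (size-shPath bs)) (sym (+-suc _ (#kind two bs)))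

module Bijection (m n k : ℕ) (k≤n : k ≤ n) (k≤m : k ≤ m) where

  s : ℕ
  s = m + n ∸ k

  s≡ : (m ∸ k) + n ≡ s
  s≡ = sym (+-∸-comm n k≤m)

  n≤s : n ≤ s
  n≤s = subst (n ≤_) s≡ (m≤n+m n (m ∸ k))

  s∸n≡m∸k : s ∸ n ≡ m ∸ k
  s∸n≡m∸k = trans (cong (_∸ n) (sym s≡)) (m+n∸n≡m (m ∸ k) n)

  record Admissible (bs : List Token) : Set where
    field
      walk : Walk 0 (shPath bs)
      stacking : LocalKinds bs
      #pair : #kind pair bs ≡ k
      #one : #kind one bs ≡ n ∸ k
      #two : #kind two bs ≡ m ∸ k

  module Encodings (bs : List Token) (adm : Admissible bs) where
    open Admissible adm

    size-sh : numN (shPath bs) ≡ s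
    size-sh = begin
      numN (shPath bs)                               ≡⟨ size-shPath bs ⟩
      #kind pair bs + #kind one bs + #kind two bs    ≡⟨ cong₂ (λ u v → u + v) (cong₂ _+_ #pair #one) #two ⟩
      k + (n ∸ k) + (m ∸ k)                          ≡⟨ cong (_+ (m ∸ k)) (m+[n∸m]≡n k≤n) ⟩
      n + (m ∸ k)                                    ≡⟨ trans (+-comm n (m ∸ k)) s≡ ⟩
      s                                              ∎
      where open ≡-Reasoning

    size-pf : numN (pfPath bs) ≡ m + n
    size-pf = trans (size-pfPath bs) (trans (cong₂ _+_ size-sh #pair) (m∸n+n≡m (≤-trans k≤m (m≤m+n m n))))

    walk-pf : Walk 0 (pfPath bs)
    walk-pf = walk-sh⇒pf 0 bs walk

    pf : PF2 m n k
    pf = record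
      { path = pfPath bs ; labels = pfLabels bs ; decor = pfDecor bs
      ; dyck = walk⇒dyck (pfPath bs) walk-pf size-pf
      ; labLen = trans (length-pfLabels bs) size-pf
      ; decLen = trans (length-pfDecor bs) size-pf
      ; labPos = pfLabels-positive bs
      ; colInc = local⇒colInc 0 0 (pfPath bs) (pfLabels bs) (localKinds⇒local bs stacking)
      ; decRise = subst (λ u → DecorsAreRises (pfDecor bs) (riseFlags u))
                        (sym (trans (areaWord≡heights (pfPath bs) walk-pf) (heights-pfPath 0 bs))) (pfDecor-rises₀ 0 bs)
      ; labIn12 = pfLabels-1or2 bs
      ; numOnes = trans (#ones bs) (trans (cong₂ _+_ #pair #one) (m+[n∸m]≡n k≤n))
      ; numTwos = trans (#twos bs) (trans (cong₂ _+_ #pair #two) (m+[n∸m]≡n k≤m))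
      ; numDec = trans (#decor bs) #pair
      }

    xs : List Row
    xs = rows 0 bs

    tots : KindTotals k n s xs
    tots = record
      { #pair≡ = trans (#kind-rows pair 0 bs) #pair
      ; #one+k≡ = trans (cong (_+ k) (trans (#kind-rows one 0 bs) #one)) (m∸n+n≡m k≤n)
      ; #two+n≡ = trans (cong (_+ n) (trans (#kind-rows two 0 bs) #two)) s≡ }

    open Standardisation k n s xs tots

    sl : List ℕ
    sl = standardise n s xs

    length-sl : length sl ≡ length xs
    length-sl = length-mapWithContext (standardLabel n s) [] xs

    stdPairs : AllPairs StdPair (zip xs sl)
    stdPairs = standardise-stdPair

    inBlocks : All (RowInBlock k n s) (zip xs sl)
    inBlocks = standardise-inBlock

    area-xs : areaWord (shPath bs) ≡ map proj₁ xs
    area-xs = trans (areaWord≡heights (shPath bs) walk) (heights-shPath 0 bs)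

    below : All (λ x → proj₁ x < length sl) xs
    below = Allₚ.map⁻ (subst (All (_< length sl)) area-xs
              (subst (λ u → All (_< u) (areaWord (shPath bs))) (sym (trans length-sl (length-rows 0 bs)))
                (subst (All (_< numN (shPath bs))) (sym (areaWord≡heights (shPath bs) walk)) (heights-bound 0 0 (shPath bs) walk z≤n))))

    module Ordered = OrderedLabelling k n s k≤n n≤s xs sl length-sl stdPairs inBlocks tots (length sl) below

    shuffle : Shuffle k n m
    shuffle = record
      { path = shPath bs ; labels = sl
      ; dyck = walk⇒dyck (shPath bs) walk size-sh
      ; labLen = trans length-sl (trans (length-rows 0 bs) size-sh)
      ; labPos = All-zip₂ xs sl length-sl (All.map (λ {z} → inBlock⇒positive z) inBlocks)
      ; colInc = local⇒colInc 0 0 (shPath bs) sl (Stacking.ordered⇒localCol k n s k≤n 0 bs sl stacking stdPairs inBlocks)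
      ; labPerm = Ordered.labels↭range
      ; sub1 = Ordered.block⊆readingWord (shPath bs) area-xs refl pair
      ; sub2 = Ordered.block⊆readingWord (shPath bs) area-xs refl one
      ; sub3 = subst (λ u → revRange (suc n) u ⊆ readingWord (shPath bs) sl) s∸n≡m∸k
                     (Ordered.block⊆readingWord (shPath bs) area-xs refl two)
      }
      where
      inBlock⇒positive : ∀ z → RowInBlock k n s z → 1 ≤ labelOf z
      inBlock⇒positive ((a , pair) , l) (p , _) = p
      inBlock⇒positive ((a , one) , l) (p , _) = ≤-trans (s≤s z≤n) p
      inBlock⇒positive ((a , two) , l) (p , _) = ≤-trans (s≤s z≤n) p
      All-zip₂ : ∀ {P : ℕ → Set} (xs : List Row) ls → length ls ≡ length xs → All (P ∘ labelOf) (zip xs ls) → All P ls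
      All-zip₂ [] [] _ _ = []
      All-zip₂ (x ∷ xs) (l ∷ ls) e (p ∷ ps) = p ∷ All-zip₂ xs ls (suc-injective e) ps

  module FromPF (x : PF2 m n k) where
    open PF2 x

    walk-path : Walk 0 path
    walk-path = dyck⇒walk path dyck

    local-col : LocalCol path labels
    local-col = colInc⇒local 0 0 path labels colInc

    encoded : EncodesPF path labels decor
    encoded = parsePF 0 false path labels decor walk-path
                (trans labLen (sym (proj₁ dyck))) (trans decLen (sym (proj₁ dyck))) labIn12 local-col
                (rises⇒afterNorth₀ path decor walk-path (subst (λ u → DecorsAreRises decor (riseFlags u)) (areaWord≡heights path walk-path) decRise))
                (λ ())

    bs : List Token
    bs = proj₁ encoded

    path≡ : pfPath bs ≡ path
    path≡ = proj₁ (proj₂ encoded)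

    labels≡ : pfLabels bs ≡ labels
    labels≡ = proj₁ (proj₂ (proj₂ encoded))

    decor≡ : pfDecor bs ≡ decor
    decor≡ = proj₂ (proj₂ (proj₂ encoded))

    #pair≡k : #kind pair bs ≡ k
    #pair≡k = trans (sym (#decor bs)) (trans (cong countTrue decor≡) numDec)

    count-rest : ∀ κ t → #kind pair bs + #kind κ bs ≡ t → #kind κ bs ≡ t ∸ k
    count-rest κ t e = trans (sym (m+n∸m≡n k (#kind κ bs))) (cong (_∸ k) (trans (cong (_+ #kind κ bs) (sym #pair≡k)) e))

    admissible : Admissible bs
    admissible = record
      { walk = walk-pf⇒sh 0 bs (subst (Walk 0) (sym path≡) walk-path)
      ; stacking = local⇒localKinds bs (subst₂ LocalCol (sym path≡) (sym labels≡) local-col)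
      ; #pair = #pair≡k
      ; #one = count-rest one n (trans (sym (#ones bs)) (trans (cong (countEq 1) labels≡) numOnes))
      ; #two = count-rest two m (trans (sym (#twos bs)) (trans (cong (countEq 2) labels≡) numTwos))
      }

  module FromShuffle (y : Shuffle k n m) where
    open Shuffle y

    walk-path : Walk 0 path
    walk-path = dyck⇒walk path dyck

    #labels : length labels ≡ numN path
    #labels = trans labLen (sym (proj₁ dyck))

    subs : ∀ κ → block k n s κ ⊆ readingWord path labels
    subs pair = sub1
    subs one = sub2
    subs two = subst (λ u → revRange (suc n) u ⊆ readingWord path labels) (sym s∸n≡m∸k) sub3

    module R = Recovery.Recover k n s k≤n n≤s path labels walk-path #labels labPerm subs

    bs : List Token
    bs = R.bs

    count : ∀ κ → #kind κ bs ≡ kindTotal k n s κ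
    count κ = trans (sym (#kind-rows κ 0 bs)) (R.count-xs κ)

    admissible : Admissible bs
    admissible = record
      { walk = subst (Walk 0) (sym (proj₁ R.tokens)) walk-path
      ; stacking = Stacking.ordered⇒localKinds k n s k≤n 0 bs labels
                     (trans #labels (cong numN (sym (proj₁ R.tokens))))
                     (subst (λ u → LocalCol u labels) (sym (proj₁ R.tokens)) (colInc⇒local 0 0 path labels colInc))
                     (subst (λ u → AllPairs StdPair (zip R.xs u)) R.recover (Standardisation.standardise-stdPair k n s R.xs R.tots))
                     (subst (λ u → All (RowInBlock k n s) (zip R.xs u)) R.recover (Standardisation.standardise-inBlock k n s R.xs R.tots))
      ; #pair = count pair
      ; #one = count one
      ; #two = trans (count two) s∸n≡m∸k
      }

  toShuffle : PF2 m n k → Shuffle k n m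
  toShuffle x = Encodings.shuffle (FromPF.bs x) (FromPF.admissible x)

  toPF : Shuffle k n m → PF2 m n k
  toPF y = Encodings.pf (FromShuffle.bs y) (FromShuffle.admissible y)

  recover-encoded : ∀ bs (adm : Admissible bs) → FromShuffle.bs (Encodings.shuffle bs adm) ≡ bs
  recover-encoded bs adm = trans (cong (tokenize (shPath bs)) kinds-sl) (tokenize-shPath bs)
    where
    open Encodings bs adm
    kinds-sl : map (Recovery.labelKind k n s k≤n n≤s) sl ≡ kinds bs
    kinds-sl = trans (Recovery.labelKinds k n s k≤n n≤s xs sl length-sl inBlocks) (kinds-rows 0 bs)

  toPF∘toShuffle : ∀ x → pfData (toPF (toShuffle x)) ≡ pfData x
  toPF∘toShuffle x = trans (cong (λ b → pfPath b , pfLabels b , pfDecor b) (recover-encoded _ (FromPF.admissible x)))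
                           (cong₂ _,_ (FromPF.path≡ x) (cong₂ _,_ (FromPF.labels≡ x) (FromPF.decor≡ x)))

  toShuffle∘toPF : ∀ y → shData (toShuffle (toPF y)) ≡ shData y
  toShuffle∘toPF y = trans (cong (λ b → shPath b , standardise n s (rows 0 b)) parsed)
                           (cong₂ _,_ (proj₁ (FromShuffle.R.tokens y)) (FromShuffle.R.recover y))
    where
    bs : List Token
    bs = FromShuffle.bs y
    x : PF2 m n k
    x = Encodings.pf bs (FromShuffle.admissible y)
    parsed : FromPF.bs x ≡ bs
    parsed = pfEncoding-injective _ _ (FromPF.path≡ x) (FromPF.labels≡ x) (FromPF.decor≡ x)

  dinv-toShuffle : ∀ x → shDinv (toShuffle x) ≡ pfDinv x
  dinv-toShuffle x = trans (DinvPreservation.dinv-preserved k n s k≤n bs E.sl E.walk-pf E.length-sl E.stdPairs E.inBlocks)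
                           (cong₂ dinvOf (FromPF.path≡ x) (FromPF.labels≡ x))
    where
    bs : List Token
    bs = FromPF.bs x
    module E = Encodings bs (FromPF.admissible x)

  area-toShuffle : ∀ x → shArea (toShuffle x) ≡ pfArea x
  area-toShuffle x = trans (area-preserved (FromPF.bs x) (Encodings.walk-pf (FromPF.bs x) (FromPF.admissible x)))
                           (cong₂ areaOf (FromPF.path≡ x) (FromPF.decor≡ x))

theorem6p1 : (m n k : ℕ) → k ≤ n → k ≤ m →
    Σ (PF2 m n k → Shuffle k n m) λ f →
    Σ (Shuffle k n m → PF2 m n k) λ g →
      (∀ x → pfData (g (f x)) ≡ pfData x) ×
      (∀ y → shData (f (g y)) ≡ shData y) ×
      (∀ x → shDinv (f x) ≡ pfDinv x) ×
      (∀ x → shArea (f x) ≡ pfArea x)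
theorem6p1 m n k k≤n k≤m = toShuffle , toPF , toPF∘toShuffle , toShuffle∘toPF , dinv-toShuffle , area-toShuffle
  where open Bijection m n k k≤n k≤m
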